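{- Let $n\ge 3$ and $k\ge 0$ be integers. Then: (1) If $S$ is a maximal reversible set in $G_n^k$, then $S$ is a maximal independent set in $G_n^k$. (2) If $n>k$ and $S$ is a maximal reversible set in $G_n^k$, then $S$ is a canonical reversible set. (3) If $S$ is a maximal reversible set in $G_n^k$ which is not a canonical reversible set, then $n\le k$ and $$|S|\le \frac{(k+1)(k+2)}{2}-\frac{n(n-1)}{2}+1.$$
   Context: The crown $S_n^k$ is the height-2 poset on $A\cup B$, $A=\{a_1,\dots,a_{n+k}\}$ minimal elements, $B=\{b_1,\dots,b_{n+k}\}$ maximal elements, indices cyclic mod $n+k$; $a_i$ is incomparable to $b_j$ iff $j\in\{i,\dots,i+k\}$ (mod $n+k$), otherwise $a_i<b_j$. $\mathrm{Inc}(A,B)$ is the set of incomparable pairs $(a,b)\in A\times B$. $G_n^k$ is the graph on $\mathrm{Inc}(A,B)$ with $(a,b)\sim(x,y)$ iff $a<y$ and $x<b$. A set $S\subseteq\mathrm{Inc}(A,B)$ is reversible if there is a linear extension $L$ of $S_n^k$ with $x>y$ in $L$ for all $(x,y)\in S$; it is a maximal reversible set if it is reversible and not properly contained in another reversible set. A subset of $A$ is contiguous if it is a block of cyclically consecutive elements $\{a_i,a_{i+1},\dots,a_{i+r}\}$ (the empty set and $A$ included). A sequence $\sigma=(x_1,\dots,x_r)$ of distinct elements of $A$ is $h$-contiguous if $\{x_1,\dots,x_i\}$ is contiguous for every $i\le r$. For such $\sigma$, $T(\sigma)$ is defined recursively: it contains all $(x_1,b)\in\mathrm{Inc}(A,B)$,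 and for $1\le i<r$ it contains $(x_{i+1},b)$ iff $(x_{i+1},b)\in\mathrm{Inc}(A,B)$ and $(x_i,b)\in T(\sigma)$. A canonical reversible set is a set of the form $T(\sigma)$ with $\sigma$ an $h$-contiguous sequence of length $k+1$. -}

module Defs where

open import Data.Nat using (ℕ; zero; suc; _+_; _*_; _∸_; _≤_; _<_; _≤ᵇ_)
open import Data.Fin using (Fin; toℕ)
open import Data.Bool using (Bool; true; false; if_then_else_)
open import Data.List using (List; []; _∷_; length; take; map; allFin)
open import Data.Nat.ListAction using (sum)
open import Data.List.Membership.Propositional using (_∈_)
open import Data.List.Relation.Unary.Unique.Propositional using (Unique)
open import Data.Product using (Σ; _×_; ∃; ∃-syntax; _,_)
open import Data.Sum using (_⊎_)
open import Data.Empty using (⊥)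
open import Function.Bundles using (_⇔_)
open import Function.Definitions using (Injective)
open import Relation.Binary.PropositionalEquality using (_≡_)
open import Relation.Nullary using (¬_)

-- The crown S_n^k has minimal elements a_i and maximal elements b_j,
-- i, j ∈ Fin (n + k) (indices cyclic mod n + k).

offset : (n k : ℕ) → Fin (n + k) → Fin (n + k) → ℕ
offset n k i j =
  if toℕ i ≤ᵇ toℕ j then toℕ j ∸ toℕ i else (toℕ j + (n + k)) ∸ toℕ i

-- a_i incomparable to b_j  iff  j ∈ {i, ..., i+k} (mod n+k)
incB : (n k : ℕ) → Fin (n + k) → Fin (n + k) → Bool
incB n k i j = offset n k i j ≤ᵇ k

Inc : (n k : ℕ) → Fin (n + k) → Fin (n + k) → Set
Inc n k i j = incB n k i j ≡ true

Lt : (n k : ℕ) → Fin (n + k) → Fin (n + k) → Set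
Lt n k i j = incB n k i j ≡ false

-- elements of the crown: inj₁ i = a_i, inj₂ j = b_j
Elem : (n k : ℕ) → Set
Elem n k = Fin (n + k) ⊎ Fin (n + k)

open import Data.Sum using (inj₁; inj₂)

record LinearExtension (n k : ℕ) : Set where
  field
    rank      : Elem n k → ℕ
    injective : Injective _≡_ _≡_ rank
    monotone  : ∀ i j → Lt n k i j → rank (inj₁ i) < rank (inj₂ j)

SubPairs : (n k : ℕ) → Set
SubPairs n k = Fin (n + k) → Fin (n + k) → Bool

Subset : (n k : ℕ) → SubPairs n k → SubPairs n k → Set
Subset n k S T = ∀ i j → S i j ≡ true → T i j ≡ true

InInc : (n k : ℕ) → SubPairs n k → Set
InInc n k S = ∀ i j → S i j ≡ true → Inc n k i j

card : (n k : ℕ) → SubPairs n k → ℕ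
card n k S =
  sum (map (λ i → sum (map (λ j → if S i j then 1 else 0) (allFin (n + k))))
           (allFin (n + k)))

Reversible : (n k : ℕ) → SubPairs n k → Set
Reversible n k S =
  InInc n k S ×
  Σ (LinearExtension n k) λ L →
    ∀ i j → S i j ≡ true →
      LinearExtension.rank L (inj₂ j) < LinearExtension.rank L (inj₁ i)

MaximalReversible : (n k : ℕ) → SubPairs n k → Set
MaximalReversible n k S =
  Reversible n k S × (∀ T → Reversible n k T → Subset n k S T → Subset n k T S)

-- the graph G_n^k on Inc(A,B): (a_i,b_j) ~ (a_x,b_y) iff a_i < b_y and a_x < b_j
Adj : (n k : ℕ) → (i j x y : Fin (n + k)) → Set
Adj n k i j x y = Lt n k i y × Lt n k x j

Independent : (n k : ℕ) → SubPairs n k → Set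
Independent n k S =
  InInc n k S ×
  (∀ i j x y → S i j ≡ true → S x y ≡ true → ¬ Adj n k i j x y)

MaximalIndependent : (n k : ℕ) → SubPairs n k → Set
MaximalIndependent n k S =
  Independent n k S × (∀ T → Independent n k T → Subset n k S T → Subset n k T S)

-- contiguous subsets of A (empty set, or cyclic block {a_i,...,a_{i+r}};
-- r ≥ n+k-1 gives all of A)
Contiguous : (n k : ℕ) → (Fin (n + k) → Set) → Set
Contiguous n k P =
  (∀ a → ¬ P a) ⊎
  Σ (Fin (n + k)) λ i → Σ ℕ λ r → ∀ a → P a ⇔ (offset n k i a ≤ r)

HContiguous : (n k : ℕ) → List (Fin (n + k)) → Set
HContiguous n k σ =
  Unique σ × (∀ m → Contiguous n k (λ a → a ∈ take m σ))

-- membership in T(σ):  (x₁,b) ∈ T iff incomparable;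
-- (x_{i+1},b) ∈ T iff incomparable and (x_i,b) ∈ T.
InT : (n k : ℕ) → List (Fin (n + k)) → Fin (n + k) → Fin (n + k) → Set
InT n k [] a b = ⊥
InT n k (x ∷ xs) a b = Inc n k x b × (a ≡ x ⊎ InT n k xs a b)

Canonical : (n k : ℕ) → SubPairs n k → Set
Canonical n k S =
  Σ (List (Fin (n + k))) λ σ →
    HContiguous n k σ × length σ ≡ suc k ×
    (∀ a b → S a b ≡ true ⇔ InT n k σ a b)

module Submission where

-- A reversible set S lies inside the set T_r of pairs (a, b) such that every a′ ranked by r at least as
-- high as a is incomparable to b, where r ranks A as a linear extension reversing S does; T_r is itself
-- reversible, so a maximal S equals T_r.  For (1), if (a, b) ∉ T_r is independent of S, let c be the
-- highest element below b: either a pair (c, y) ∈ S is adjacent to (a, b), or moving a just above c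
-- gives a reversible set strictly larger than S.
--
-- For (2) and (3), (a, b) ∈ T_r says that the window ↓b of the n − 1 elements below b avoids the up-set
-- Y_a of a.  A set missing a point covers at most (its size) − (n − 2) windows; applied to the complement
-- of Y_a this bounds the row of the element on level t by k + 1 − t, so only the top k + 1 levels carry
-- pairs.  Going down the levels we keep every up-set contiguous, if necessary by re-ranking a neighbour of
-- the current block just above the next level.  If this succeeds for the top k + 1 levels, they form an
-- h-contiguous σ with S = T(σ).  Otherwise both neighbours are obstructed; the complement of the up-set
-- then splits into two gaps of size at least n − 1 which no window straddles, and summing the resulting
-- per-level deficits gives n ≤ k and the bound on |S|.

open import Defs
open import Data.Bool using (Bool; true; false; not; _∧_; if_then_else_)
open import Data.Bool.Properties using (T-≡; not-injective; ¬-not; ∧-zeroʳ; ∧-identityʳ; ∧-conicalˡ; ∧-conicalʳ) renaming (_≟_ to _≟ᵇ_)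
open import Data.Empty using (⊥-elim)
open import Data.Fin using (Fin; zero; suc; toℕ; fromℕ<; punchIn)
open import Data.Fin.Permutation using (Permutation′; permutation)
open import Data.Fin.Properties using (toℕ<n; toℕ-injective; toℕ-fromℕ<; punchInᵢ≢i; all?; any?; ¬∀⟶∃¬) renaming (_≟_ to _≟ᶠ_)
open import Data.List using (_∷_; allFin; filter; tabulate; map; take; applyUpTo)
open import Data.List.Membership.Propositional using (_∈_)
open import Data.List.Membership.Propositional.Properties using (∈-filter⁺; ∈-allFin; ∈-tabulate⁺; ∈-applyUpTo⁺; ∈-applyUpTo⁻)
open import Data.List.Properties using (map-tabulate; length-applyUpTo)
open import Data.List.Relation.Unary.All using (lookup)
open import Data.List.Relation.Unary.All.Properties using (all-filter; tabulate⁺)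
open import Data.List.Relation.Unary.Unique.Propositional.Properties using (applyUpTo⁺₁)
open import Data.Nat using (ℕ; zero; suc; _+_; _*_; _∸_; _≤_; _<_; _≤ᵇ_; _⊓_; z≤n; s≤s; z<s; _≤?_; _<?_)
open import Data.Nat.DivMod using (_%_; [m+kn]%n≡m%n; m<n⇒m%n≡m)
import Data.Nat.ListAction as List
open import Data.Nat.Properties
open import Data.Nat.Tactic.RingSolver using (solve-∀)
open import Data.List.Extrema ≤-totalOrder using (argmax; argmax-all; f[xs]≤f[argmax]; max; xs≤max; max≤v⁺)
open import Algebra.Properties.CommutativeMonoid.Sum +-0-commutativeMonoid
  using (sum; sum-cong-≗; sum-remove; sum-permute) renaming (∑-distrib-+ to sum-distrib-+)
open import Data.Product using (Σ; ∃; _×_; _,_; proj₁; proj₂)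
open import Data.Sum using (_⊎_; inj₁; inj₂; [_,_]′)
import Data.Sum as Sum
open import Data.Unit using (⊤; tt)
open import Data.Vec.Functional using (removeAt)
open import Function using (_∘_; _∘′_; id)
open import Function.Bundles using (_⇔_; Equivalence; mk⇔)
open import Function.Definitions using (Injective)
open import Relation.Binary using (Tri; tri<; tri≈; tri>)
open import Relation.Binary.PropositionalEquality
open import Relation.Nullary using (¬_; Dec; yes; no; contradiction)
open import Relation.Nullary.Decidable using (⌊_⌋; _→-dec_; _×-dec_)
open import Relation.Unary using (Pred; Decidable)

bool-ext : ∀ {x y : Bool} → (x ≡ true → y ≡ true) → (y ≡ true → x ≡ true) → x ≡ y
bool-ext {false} {false} _ _ = refl
bool-ext {false} {true}  _ g = g refl
bool-ext {true}  {_}     f _ = sym (f refl)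

≤ᵇ-true : ∀ {m n} → m ≤ n → (m ≤ᵇ n) ≡ true
≤ᵇ-true m≤n = Equivalence.to T-≡ (≤⇒≤ᵇ m≤n)

≤ᵇ-false : ∀ {m n} → n < m → (m ≤ᵇ n) ≡ false
≤ᵇ-false {m} {n} n<m with m ≤ᵇ n in eq
... | true  = contradiction (≤ᵇ⇒≤ m n (Equivalence.from T-≡ eq)) (<⇒≱ n<m)
... | false = refl

true-≤ᵇ : ∀ {m n} → (m ≤ᵇ n) ≡ true → m ≤ n
true-≤ᵇ {m} {n} eq = ≤ᵇ⇒≤ m n (Equivalence.from T-≡ eq)

false-≤ᵇ : ∀ {m n} → (m ≤ᵇ n) ≡ false → n < m
false-≤ᵇ {m} {n} eq = ≰⇒> λ m≤n → contradiction (trans (sym eq) (≤ᵇ-true m≤n)) λ ()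

≤ᵇ-suc : ∀ {x j} → x ≢ suc j → (x ≤ᵇ j) ≡ (x ≤ᵇ suc j)
≤ᵇ-suc {x} {j} x≢1+j with x ≤? j
... | yes x≤j = trans (≤ᵇ-true x≤j) (sym (≤ᵇ-true (m≤n⇒m≤1+n x≤j)))
... | no  x≰j = trans (≤ᵇ-false (≰⇒> x≰j)) (sym (≤ᵇ-false (≤∧≢⇒< (≰⇒> x≰j) (x≢1+j ∘ sym))))

<⇒≤∸1 : ∀ {m n} → m < n → m ≤ n ∸ 1
<⇒≤∸1 (s≤s m≤n) = m≤n

sum-mono-≤ : ∀ {m} {f g : Fin m → ℕ} → (∀ i → f i ≤ g i) → sum f ≤ sum g
sum-mono-≤ {zero}  f≤g = z≤n
sum-mono-≤ {suc m} f≤g = +-mono-≤ (f≤g zero) (sum-mono-≤ (f≤g ∘ suc))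

sum-allFin : ∀ {m} (f : Fin m → ℕ) → List.sum (map f (allFin m)) ≡ sum f
sum-allFin {m} f = trans (cong List.sum (map-tabulate (λ i → i) f)) (tabulate-sum f)
  where
  tabulate-sum : ∀ {m} (f : Fin m → ℕ) → List.sum (tabulate f) ≡ sum f
  tabulate-sum {zero}  f = refl
  tabulate-sum {suc m} f = cong (f zero +_) (tabulate-sum (f ∘ suc))

sum-pos : ∀ {m} (f : Fin m → ℕ) → 0 < sum f → ∃ λ i → 0 < f i
sum-pos {suc m} f pos with f zero in eq
... | suc _ = zero , subst (0 <_) (sym eq) (s≤s z≤n)
... | zero with sum-pos (f ∘ suc) pos
...   | i , fi>0 = suc i , fi>0

argmax-exists : ∀ {m p} {P : Pred (Fin m) p} → Decidable P → (f : Fin m → ℕ) →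
                ∀ {x} → P x → ∃ λ c → P c × (∀ y → P y → f y ≤ f c)
argmax-exists {m} P? f {x} px =
  c , argmax-all f px (all-filter P? (allFin m)) ,
  λ y py → lookup (f[xs]≤f[argmax] x xs) (∈-filter⁺ P? (∈-allFin y) py)
  where
  xs = filter P? (allFin m)
  c  = argmax f x xs

⟦_⟧ : Bool → ℕ
⟦ b ⟧ = if b then 1 else 0

count : ∀ {m} → (Fin m → Bool) → ℕ
count P = sum λ a → ⟦ P a ⟧

_⊆ᵇ_ : ∀ {m} → (Fin m → Bool) → (Fin m → Bool) → Set
P ⊆ᵇ Q = ∀ a → P a ≡ true → Q a ≡ true

⟦⟧-mono : ∀ {b c} → (b ≡ true → c ≡ true) → ⟦ b ⟧ ≤ ⟦ c ⟧
⟦⟧-mono {false} _ = z≤n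
⟦⟧-mono {true}  h rewrite h refl = ≤-refl

⟦⟧≤1 : ∀ b → ⟦ b ⟧ ≤ 1
⟦⟧≤1 false = z≤n
⟦⟧≤1 true  = ≤-refl

count-cong : ∀ {m} {P Q : Fin m → Bool} → (∀ a → P a ≡ Q a) → count P ≡ count Q
count-cong P≗Q = sum-cong-≗ (cong ⟦_⟧ ∘ P≗Q)

count-mono : ∀ {m} {P Q : Fin m → Bool} → P ⊆ᵇ Q → count P ≤ count Q
count-mono P⊆Q = sum-mono-≤ (⟦⟧-mono ∘ P⊆Q)

count-const : ∀ m b → count {m} (λ _ → b) ≡ m * ⟦ b ⟧
count-const zero    b = refl
count-const (suc m) b = cong (⟦ b ⟧ +_) (count-const m b)

count-all : ∀ {m} {P : Fin m → Bool} → (∀ a → P a ≡ true) → count P ≡ m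
count-all {m} all = trans (count-cong all) (trans (count-const m true) (*-identityʳ m))

count-≤ : ∀ {m} (P : Fin m → Bool) → count P ≤ m
count-≤ {m} P = subst (count P ≤_) (count-all {m} {λ _ → true} λ _ → refl) (count-mono {m} {P} λ _ _ → refl)

count-pos : ∀ {m} (P : Fin m → Bool) → 0 < count P → ∃ λ a → P a ≡ true
count-pos P pos with sum-pos (λ a → ⟦ P a ⟧) pos
... | a , Pa>0 with P a in eq
...   | true = a , eq

count-not : ∀ {m} (P : Fin m → Bool) → count (not ∘ P) + count P ≡ m
count-not {m} P = trans (sym (sum-distrib-+ (λ a → ⟦ not (P a) ⟧) (λ a → ⟦ P a ⟧)))
                        (trans (sum-cong-≗ complement) (count-all {m} {λ _ → true} λ _ → refl))
  where
  complement : ∀ a → ⟦ not (P a) ⟧ + ⟦ P a ⟧ ≡ 1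
  complement a with P a
  ... | true  = refl
  ... | false = refl

count-remove : ∀ {m} (P : Fin (suc m) → Bool) x → count P ≡ ⟦ P x ⟧ + count (removeAt P x)
count-remove P x = sum-remove {i = x} (λ a → ⟦ P a ⟧)

removeAt-agree : ∀ {m} {P Q : Fin (suc m) → Bool} x → (∀ a → a ≢ x → P a ≡ Q a) →
                 ∀ j → removeAt P x j ≡ removeAt Q x j
removeAt-agree x agree j = agree (punchIn x j) (punchInᵢ≢i x j)

count-insert : ∀ {m} {P Q : Fin m → Bool} x → P x ≡ false → Q x ≡ true →
               (∀ a → a ≢ x → P a ≡ Q a) → count Q ≡ suc (count P)
count-insert {suc m} {P} {Q} x Px Qx agree = begin
  count Q                          ≡⟨ count-remove Q x ⟩
  ⟦ Q x ⟧ + count (removeAt Q x)   ≡⟨ cong₂ _+_ (cong ⟦_⟧ Qx) (count-cong (sym ∘ removeAt-agree x agree)) ⟩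
  suc (count (removeAt P x))       ≡⟨ cong (λ b → suc (⟦ b ⟧ + count (removeAt P x))) Px ⟨
  suc (⟦ P x ⟧ + count (removeAt P x)) ≡⟨ cong suc (count-remove P x) ⟨
  suc (count P)                    ∎
  where open ≡-Reasoning

count-⊆-insert : ∀ {m} {P Q : Fin m → Bool} x → (∀ a → a ≢ x → Q a ≡ true → P a ≡ true) →
                 count Q ≤ suc (count P)
count-⊆-insert {suc m} {P} {Q} x Q⊆P∪x = begin
  count Q                              ≡⟨ count-remove Q x ⟩
  ⟦ Q x ⟧ + count (removeAt Q x)       ≤⟨ +-mono-≤ (⟦⟧≤1 (Q x)) (count-mono λ j → Q⊆P∪x _ (punchInᵢ≢i x j)) ⟩
  suc (count (removeAt P x))           ≤⟨ s≤s (m≤n+m _ ⟦ P x ⟧) ⟩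
  suc (⟦ P x ⟧ + count (removeAt P x)) ≡⟨ cong suc (count-remove P x) ⟨
  suc (count P)                        ∎
  where open ≤-Reasoning

count-strict : ∀ {m} {P Q : Fin m → Bool} x → P ⊆ᵇ Q → P x ≡ false → Q x ≡ true →
               count P < count Q
count-strict {suc m} {P} {Q} x P⊆Q Px Qx = begin-strict
  count P                          ≡⟨ count-remove P x ⟩
  ⟦ P x ⟧ + count (removeAt P x)   ≡⟨ cong (λ b → ⟦ b ⟧ + count (removeAt P x)) Px ⟩
  count (removeAt P x)             ≤⟨ count-mono (P⊆Q ∘ punchIn x) ⟩
  count (removeAt Q x)             <⟨ n<1+n _ ⟩
  suc (count (removeAt Q x))       ≡⟨ cong (λ b → ⟦ b ⟧ + count (removeAt Q x)) Qx ⟨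
  ⟦ Q x ⟧ + count (removeAt Q x)   ≡⟨ count-remove Q x ⟨
  count Q                          ∎
  where open ≤-Reasoning

count-none : ∀ {m} {P : Fin m → Bool} → (∀ a → P a ≡ false) → count P ≡ 0
count-none {m} none = trans (count-cong none) (trans (count-const m false) (*-zeroʳ m))

count-∪ : ∀ {m} {P Q R : Fin m → Bool} → (∀ a → P a ≡ true → Q a ≡ true ⊎ R a ≡ true) →
          count P ≤ count Q + count R
count-∪ {P = P} {Q} {R} P⊆Q∪R =
  subst (count P ≤_) (sum-distrib-+ (λ a → ⟦ Q a ⟧) (λ a → ⟦ R a ⟧)) (sum-mono-≤ pointwise)
  where
  pointwise : ∀ a → ⟦ P a ⟧ ≤ ⟦ Q a ⟧ + ⟦ R a ⟧
  pointwise a with P a in eq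
  ... | false = z≤n
  ... | true with P⊆Q∪R a eq
  ...   | inj₁ Qa = subst (λ b → 1 ≤ ⟦ b ⟧ + ⟦ R a ⟧) (sym Qa) (s≤s z≤n)
  ...   | inj₂ Ra = subst (λ b → 1 ≤ ⟦ Q a ⟧ + ⟦ b ⟧) (sym Ra) (m≤n+m 1 ⟦ Q a ⟧)

count-partition : ∀ {m} {P G H : Fin m → Bool} → (∀ a → P a ≡ true → G a ≡ true ⊎ H a ≡ true) →
                  (∀ a → G a ≡ true → H a ≡ false) → count P ≡ count (λ a → P a ∧ G a) + count (λ a → P a ∧ H a)
count-partition {P = P} {G} {H} P⊆G∪H G∩H≡∅ =
  trans (sum-cong-≗ pointwise) (sum-distrib-+ (λ a → ⟦ P a ∧ G a ⟧) (λ a → ⟦ P a ∧ H a ⟧))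
  where
  pointwise : ∀ a → ⟦ P a ⟧ ≡ ⟦ P a ∧ G a ⟧ + ⟦ P a ∧ H a ⟧
  pointwise a with P a in eq
  ... | false = refl
  ... | true with P⊆G∪H a eq
  ...   | inj₁ Ga rewrite Ga | G∩H≡∅ a Ga = refl
  ...   | inj₂ Ha rewrite Ha with G a in eqG
  ...     | false = refl
  ...     | true  = contradiction (trans (sym Ha) (G∩H≡∅ a eqG)) λ ()

sumTo : ℕ → (ℕ → ℕ) → ℕ
sumTo zero    h = 0
sumTo (suc m) h = h 0 + sumTo m (λ t → h (suc t))

sum-toℕ : ∀ m (h : ℕ → ℕ) → sum (λ (i : Fin m) → h (toℕ i)) ≡ sumTo m h
sum-toℕ zero    h = refl
sum-toℕ (suc m) h = cong (h 0 +_) (sum-toℕ m (λ t → h (suc t)))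

sumTo-cong : ∀ m {f g : ℕ → ℕ} → (∀ t → t < m → f t ≡ g t) → sumTo m f ≡ sumTo m g
sumTo-cong zero    eq = refl
sumTo-cong (suc m) eq = cong₂ _+_ (eq 0 (s≤s z≤n)) (sumTo-cong m λ t t<m → eq (suc t) (s≤s t<m))

sumTo-mono-≤ : ∀ m {f g : ℕ → ℕ} → (∀ t → t < m → f t ≤ g t) → sumTo m f ≤ sumTo m g
sumTo-mono-≤ zero    le = z≤n
sumTo-mono-≤ (suc m) le = +-mono-≤ (le 0 (s≤s z≤n)) (sumTo-mono-≤ m λ t t<m → le (suc t) (s≤s t<m))

sumTo-distrib-+ : ∀ m (f g : ℕ → ℕ) → sumTo m (λ t → f t + g t) ≡ sumTo m f + sumTo m g
sumTo-distrib-+ zero    f g = refl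
sumTo-distrib-+ (suc m) f g = trans (cong (f 0 + g 0 +_) (sumTo-distrib-+ m _ _))
                                    (shuffle (f 0) (g 0) (sumTo m (λ t → f (suc t))) (sumTo m (λ t → g (suc t))))
  where
  shuffle : ∀ a b c d → a + b + (c + d) ≡ a + c + (b + d)
  shuffle = solve-∀

sumTo-split : ∀ a b (h : ℕ → ℕ) → sumTo (a + b) h ≡ sumTo a h + sumTo b (λ s → h (a + s))
sumTo-split zero    b h = refl
sumTo-split (suc a) b h = trans (cong (h 0 +_) (sumTo-split a b (λ t → h (suc t)))) (sym (+-assoc (h 0) _ _))

sumTo-prefix : ∀ {a b} (h : ℕ → ℕ) → a ≤ b → sumTo a h ≤ sumTo b h
sumTo-prefix {zero}          h _         = z≤n
sumTo-prefix {suc a} {suc b} h (s≤s a≤b) = +-monoʳ-≤ (h 0) (sumTo-prefix (λ t → h (suc t)) a≤b)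

sumTo-countdown : ∀ K m → K ≤ m → 2 * sumTo m (λ t → K ∸ t) ≡ K * suc K
sumTo-countdown zero    m       _         = cong (2 *_) (trans (sumTo-cong m λ t _ → 0∸n≡0 t) (zeros m))
  where
  zeros : ∀ m → sumTo m (λ _ → 0) ≡ 0
  zeros zero    = refl
  zeros (suc m) = zeros m
sumTo-countdown (suc K) (suc m) (s≤s K≤m) = begin
  2 * (suc K + sumTo m (λ t → K ∸ t))       ≡⟨ *-distribˡ-+ 2 (suc K) _ ⟩
  2 * suc K + 2 * sumTo m (λ t → K ∸ t)     ≡⟨ cong (2 * suc K +_) (sumTo-countdown K m K≤m) ⟩
  2 * suc K + K * suc K                     ≡⟨ shuffle K ⟩
  suc K * suc (suc K)                       ∎
  where
  open ≡-Reasoning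
  shuffle : ∀ K → 2 * suc K + K * suc K ≡ suc K * suc (suc K)
  shuffle = solve-∀

staircase : ℕ → ℕ → ℕ
staircase m zero    = 0
staircase m (suc v) = staircase m v + (suc v ⊓ m)

slow-descent : ∀ D (f : ℕ → ℕ) m {v} → f D ≤ 1 → (∀ s → s < D → f s ≤ suc (f (suc s))) → v ≤ f 0 →
               staircase m v ≤ sumTo (suc D) (λ s → f s ⊓ m)
slow-descent D       f m {zero}        _    _    _   = z≤n
slow-descent zero    f m {suc zero}    _    _    v≤f = ≤-trans (⊓-monoˡ-≤ m v≤f) (≤-reflexive (sym (+-identityʳ _)))
slow-descent zero    f m {suc (suc v)} f≤1  _    v≤f = contradiction (≤-trans v≤f f≤1) λ { (s≤s ()) }
slow-descent (suc D) f m {suc v}       f≤1  step v≤f =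
  subst (_≤ sumTo (suc (suc D)) (λ s → f s ⊓ m)) (+-comm (suc v ⊓ m) (staircase m v))
        (+-mono-≤ (⊓-monoˡ-≤ m v≤f)
                  (slow-descent D (λ s → f (suc s)) m f≤1 (λ s s<D → step (suc s) (s≤s s<D))
                                (≤-pred (≤-trans v≤f (step 0 (s≤s z≤n))))))

private
  staircase-below : ∀ m v → v ≤ m → 2 * staircase m v ≡ v * suc v
  staircase-below m zero    _   = refl
  staircase-below m (suc v) v<m = begin
    2 * (staircase m v + (suc v ⊓ m)) ≡⟨ cong (λ z → 2 * (staircase m v + z)) (m≤n⇒m⊓n≡m v<m) ⟩
    2 * (staircase m v + suc v)       ≡⟨ *-distribˡ-+ 2 (staircase m v) (suc v) ⟩
    2 * staircase m v + 2 * suc v     ≡⟨ cong (_+ 2 * suc v) (staircase-below m v (≤-trans (n≤1+n v) v<m)) ⟩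
    v * suc v + 2 * suc v             ≡⟨ shuffle v ⟩
    suc v * suc (suc v)               ∎
    where
    open ≡-Reasoning
    shuffle : ∀ v → v * suc v + 2 * suc v ≡ suc v * suc (suc v)
    shuffle = solve-∀

staircase-top : ∀ n → 2 ≤ n → 2 * staircase (n ∸ 2) (n ∸ 1) + 2 ≡ n * (n ∸ 1)
staircase-top (suc (suc m)) (s≤s (s≤s _)) = begin
  2 * (staircase m m + (suc m ⊓ m)) + 2 ≡⟨ cong (λ z → 2 * (staircase m m + z) + 2) (m≥n⇒m⊓n≡n (n≤1+n m)) ⟩
  2 * (staircase m m + m) + 2         ≡⟨ cong (_+ 2) (*-distribˡ-+ 2 (staircase m m) m) ⟩
  2 * staircase m m + 2 * m + 2       ≡⟨ cong (λ z → z + 2 * m + 2) (staircase-below m m ≤-refl) ⟩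
  m * suc m + 2 * m + 2               ≡⟨ shuffle m ⟩
  suc (suc m) * suc m                 ∎
  where
  open ≡-Reasoning
  shuffle : ∀ m → m * suc m + 2 * m + 2 ≡ suc (suc m) * suc m
  shuffle = solve-∀

private
  regroup : ∀ x y z w → x + y + z + w ≡ (w + x) + (z + y)
  regroup = solve-∀

  budget-≤ : ∀ {β p q m T} → m ≤ p → β ≤ (p ∸ m) + (q ∸ m) → p + q ≡ T + m → β + (p ⊓ q ⊓ T) ⊓ m ≤ T
  budget-≤ {β} {p} {q} {m} {T} m≤p β≤ p+q≡T+m = +-cancelʳ-≤ m _ _ (begin
    β + μ + m                                  ≤⟨ +-monoˡ-≤ m (+-mono-≤ β≤ (⊓-glb μ≤q (m⊓n≤n _ m))) ⟩
    (p ∸ m) + (q ∸ m) + (q ⊓ m) + m            ≡⟨ cong₂ (λ u v → (p ∸ m) + (q ∸ m) + u + v)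
                                                         (⊓-comm q m) (sym (m≤n⇒m⊓n≡m m≤p)) ⟩
    (p ∸ m) + (q ∸ m) + (m ⊓ q) + (m ⊓ p)      ≡⟨ regroup (p ∸ m) (q ∸ m) (m ⊓ q) (m ⊓ p) ⟩
    ((m ⊓ p) + (p ∸ m)) + ((m ⊓ q) + (q ∸ m))  ≡⟨ cong₂ _+_ (m⊓n+n∸m≡n m p) (m⊓n+n∸m≡n m q) ⟩
    p + q                                      ≡⟨ p+q≡T+m ⟩
    T + m                                      ∎)
    where
    open ≤-Reasoning
    μ = (p ⊓ q ⊓ T) ⊓ m
    μ≤q : μ ≤ q
    μ≤q = ≤-trans (m⊓n≤m _ m) (≤-trans (m⊓n≤m (p ⊓ q) T) (m⊓n≤n p q))

level-budget : ∀ {β p q m T} → β ≤ (p ∸ m) + (q ∸ m) → p + q ≡ T + m → β + (p ⊓ q ⊓ T) ⊓ m ≤ T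
level-budget {β} {p} {q} {m} {T} β≤ p+q≡T+m with m ≤? p | m ≤? q
... | yes m≤p | _       = budget-≤ m≤p β≤ p+q≡T+m
... | no  _   | yes m≤q = subst (λ x → β + (x ⊓ T) ⊓ m ≤ T) (⊓-comm q p)
                            (budget-≤ m≤q (subst (β ≤_) (+-comm (p ∸ m) (q ∸ m)) β≤) (trans (+-comm q p) p+q≡T+m))
... | no  m≰p | no  m≰q = begin
  β + (p ⊓ q ⊓ T) ⊓ m   ≤⟨ +-mono-≤ β≤ (≤-trans (m⊓n≤m _ m) (m⊓n≤n _ T)) ⟩
  (p ∸ m) + (q ∸ m) + T ≡⟨ cong₂ (λ x y → x + y + T) (m≤n⇒m∸n≡0 (<⇒≤ (≰⇒> m≰p)))
                                                      (m≤n⇒m∸n≡0 (<⇒≤ (≰⇒> m≰q))) ⟩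
  T                     ∎
  where open ≤-Reasoning

∸-suc-split : ∀ n k t → 2 ≤ n → t ≤ k → n + k ∸ suc t ≡ (suc k ∸ t) + (n ∸ 2)
∸-suc-split (suc (suc m)) k t (s≤s (s≤s _)) t≤k = begin
  suc m + k ∸ t     ≡⟨ cong (λ x → suc x ∸ t) (+-comm m k) ⟩
  suc k + m ∸ t     ≡⟨ +-∸-comm m (m≤n⇒m≤1+n t≤k) ⟩
  (suc k ∸ t) + m   ∎
  where open ≡-Reasoning

∸-suc-∸ : ∀ n k t → 2 ≤ n → (n + k ∸ suc t) ∸ (n ∸ 2) ≡ suc k ∸ t
∸-suc-∸ (suc (suc m)) k t (s≤s (s≤s _)) = begin
  (suc m + k ∸ t) ∸ m    ≡⟨ ∸-+-assoc (suc m + k) t m ⟩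
  suc m + k ∸ (t + m)    ≡⟨ cong₂ _∸_ (cong suc (+-comm m k)) (+-comm t m) ⟩
  suc k + m ∸ (m + t)    ≡⟨ cong (_∸ (m + t)) (+-comm (suc k) m) ⟩
  m + suc k ∸ (m + t)    ≡⟨ [m+n]∸[m+o]≡n∸o m (suc k) t ⟩
  suc k ∸ t              ∎
  where open ≡-Reasoning

+∸2≡∸1+∸1 : ∀ n → 2 ≤ n → n + (n ∸ 2) ≡ (n ∸ 1) + (n ∸ 1)
+∸2≡∸1+∸1 (suc (suc m)) (s≤s (s≤s _)) = cong suc (sym (+-suc m m))

take-applyUpTo : ∀ {A : Set} (f : ℕ → A) m d → take m (applyUpTo f d) ≡ applyUpTo f (m ⊓ d)
take-applyUpTo f zero    d       = refl
take-applyUpTo f (suc m) zero    = refl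
take-applyUpTo f (suc m) (suc d) = cong (f 0 ∷_) (take-applyUpTo (f ∘′ suc) m d)


module Crown (n k : ℕ) where

  -- Cyclic distance

  N : ℕ
  N = n + k

  opaque
    dist : Fin N → Fin N → ℕ
    dist = offset n k

    dist≡offset : ∀ i j → dist i j ≡ offset n k i j
    dist≡offset i j = refl

  Reaches : ℕ → ℕ → ℕ → Set
  Reaches I v J = I + v ≡ J ⊎ I + v ≡ J + N

  reaches-unique : ∀ {I J v w} → v < N → w < N → Reaches I v J → Reaches I w J → v ≡ w
  reaches-unique {I} v<N w<N (inj₁ p) (inj₁ q) = +-cancelˡ-≡ I _ _ (trans p (sym q))
  reaches-unique {I} v<N w<N (inj₂ p) (inj₂ q) = +-cancelˡ-≡ I _ _ (trans p (sym q))
  reaches-unique {I} {J} {v} {w} v<N w<N (inj₁ p) (inj₂ q) =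
    contradiction (subst (_< N) (+-cancelˡ-≡ I w (v + N) (trans q (trans (cong (_+ N) (sym p)) (+-assoc I v N)))) w<N)
                  (m+n≮n v N)
  reaches-unique {I} {J} {v} {w} v<N w<N (inj₂ p) (inj₁ q) =
    contradiction (subst (_< N) (+-cancelˡ-≡ I v (w + N) (trans p (trans (cong (_+ N) (sym q)) (+-assoc I w N)))) v<N)
                  (m+n≮n w N)

  private
    cyclicDiff : ℕ → ℕ → ℕ
    cyclicDiff I J = if I ≤ᵇ J then J ∸ I else (J + N) ∸ I

    cyclicDiff-spec : ∀ I J → I < N → J < N → cyclicDiff I J < N × Reaches I (cyclicDiff I J) J
    cyclicDiff-spec I J I<N J<N with I ≤ᵇ J in eq
    ... | true  = ≤-<-trans (m∸n≤m J I) J<N , inj₁ (m+[n∸m]≡n (true-≤ᵇ {I} {J} eq))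
    ... | false = +-cancelˡ-< I _ _ (subst (_< I + N) (sym (m+[n∸m]≡n I≤J+N)) (+-monoˡ-< N (false-≤ᵇ {I} {J} eq)))
                , inj₂ (m+[n∸m]≡n I≤J+N)
      where
      I≤J+N : I ≤ J + N
      I≤J+N = ≤-trans (<⇒≤ I<N) (m≤n+m N J)

    dist-spec : ∀ i j → dist i j < N × Reaches (toℕ i) (dist i j) (toℕ j)
    dist-spec i j = subst (λ d → d < N × Reaches (toℕ i) d (toℕ j)) (sym (dist≡offset i j))
                          (cyclicDiff-spec (toℕ i) (toℕ j) (toℕ<n i) (toℕ<n j))

  dist<N : ∀ i j → dist i j < N
  dist<N i j = proj₁ (dist-spec i j)

  dist-reaches : ∀ i j → Reaches (toℕ i) (dist i j) (toℕ j)
  dist-reaches i j = proj₂ (dist-spec i j)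

  dist-unique : ∀ {i j v} → v < N → Reaches (toℕ i) v (toℕ j) → dist i j ≡ v
  dist-unique {i} {j} v<N r = reaches-unique (dist<N i j) v<N (dist-reaches i j) r

  dist-self : ∀ i → dist i i ≡ 0
  dist-self i = dist-unique (≤-<-trans z≤n (toℕ<n i)) (inj₁ (+-identityʳ (toℕ i)))

  reaches-injective : ∀ {I v J J'} → J < N → J' < N → Reaches I v J → Reaches I v J' → J ≡ J'
  reaches-injective J<N J'<N (inj₁ p) (inj₁ q) = trans (sym p) q
  reaches-injective J<N J'<N (inj₂ p) (inj₂ q) = +-cancelʳ-≡ N _ _ (trans (sym p) q)
  reaches-injective {J' = J'} J<N J'<N (inj₁ p) (inj₂ q) = contradiction (subst (_< N) (trans (sym p) q) J<N) (m+n≮n J' N)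
  reaches-injective {J = J} J<N J'<N (inj₂ p) (inj₁ q) = contradiction (subst (_< N) (trans (sym q) p) J'<N) (m+n≮n J N)

  dist-injectiveʳ : ∀ i {j j'} → dist i j ≡ dist i j' → j ≡ j'
  dist-injectiveʳ i {j} {j'} eq = toℕ-injective (reaches-injective {toℕ i} {dist i j} (toℕ<n j) (toℕ<n j')
    (dist-reaches i j) (subst (λ v → Reaches (toℕ i) v (toℕ j')) (sym eq) (dist-reaches i j')))

  dist≡0⇒≡ : ∀ {i j} → dist i j ≡ 0 → i ≡ j
  dist≡0⇒≡ {i} eq = dist-injectiveʳ i (trans (dist-self i) (sym eq))

  ≢⇒dist>0 : ∀ {i j} → i ≢ j → 0 < dist i j
  ≢⇒dist>0 i≢j = n≢0⇒n>0 (i≢j ∘ dist≡0⇒≡)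

  dist-surjectiveʳ : ∀ i {v} → v < N → ∃ λ j → dist i j ≡ v
  dist-surjectiveʳ i {v} v<N with toℕ i + v <? N
  ... | yes i+v<N = fromℕ< i+v<N , dist-unique v<N (inj₁ (sym (toℕ-fromℕ< i+v<N)))
  ... | no  i+v≮N = fromℕ< i+v-N<N ,
                    dist-unique v<N (inj₂ (trans (sym (m∸n+n≡m N≤i+v)) (cong (_+ N) (sym (toℕ-fromℕ< i+v-N<N)))))
    where
    N≤i+v : N ≤ toℕ i + v
    N≤i+v = ≮⇒≥ i+v≮N
    i+v-N<N : toℕ i + v ∸ N < N
    i+v-N<N = +-cancelʳ-< N _ _ (subst (_< N + N) (sym (m∸n+n≡m N≤i+v)) (+-mono-< (toℕ<n i) v<N))

  private
    Wrap : ℕ → Set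
    Wrap e = e ≡ 0 ⊎ e ≡ N

    dist-wrap : ∀ i j → ∃ λ e → Wrap e × toℕ i + dist i j ≡ toℕ j + e
    dist-wrap i j with dist-reaches i j
    ... | inj₁ p = 0 , inj₁ refl , trans p (sym (+-identityʳ (toℕ j)))
    ... | inj₂ p = N , inj₂ refl , p

    chain : ∀ C A B u o w e₁ e₂ e₃ → C + u ≡ A + e₁ → A + o ≡ B + e₂ → C + w ≡ B + e₃ →
            u + o + e₃ ≡ w + (e₁ + e₂)
    chain C A B u o w e₁ e₂ e₃ h₁ h₂ h₃ = +-cancelˡ-≡ C _ _ (begin
      C + (u + o + e₃)    ≡⟨ shuffle₁ C u o e₃ ⟩
      (C + u) + o + e₃    ≡⟨ cong (λ x → x + o + e₃) h₁ ⟩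
      (A + e₁) + o + e₃   ≡⟨ shuffle₂ A e₁ o e₃ ⟩
      (A + o) + e₁ + e₃   ≡⟨ cong (λ x → x + e₁ + e₃) h₂ ⟩
      (B + e₂) + e₁ + e₃  ≡⟨ shuffle₃ B e₂ e₁ e₃ ⟩
      (B + e₃) + (e₁ + e₂) ≡⟨ cong (_+ (e₁ + e₂)) (sym h₃) ⟩
      (C + w) + (e₁ + e₂) ≡⟨ +-assoc C w (e₁ + e₂) ⟩
      C + (w + (e₁ + e₂)) ∎)
      where
      open ≡-Reasoning
      shuffle₁ : ∀ a b c d → a + (b + c + d) ≡ (a + b) + c + d
      shuffle₁ = solve-∀
      shuffle₂ : ∀ a b c d → (a + b) + c + d ≡ (a + c) + b + d
      shuffle₂ = solve-∀
      shuffle₃ : ∀ a b c d → (a + b) + c + d ≡ (a + d) + (c + b)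
      shuffle₃ = solve-∀

  dist-triangle : ∀ c a b → dist c a + dist a b ≡ dist c b ⊎ dist c a + dist a b ≡ dist c b + N
  dist-triangle c a b with dist-wrap c a | dist-wrap a b | dist-wrap c b
  ... | e₁ , w₁ , h₁ | e₂ , w₂ , h₂ | e₃ , w₃ , h₃ =
    cases w₁ w₂ w₃ (chain (toℕ c) (toℕ a) (toℕ b) u o w e₁ e₂ e₃ h₁ h₂ h₃)
    where
    u = dist c a
    o = dist a b
    w = dist c b
    open ≤-Reasoning
    cases : Wrap e₁ → Wrap e₂ → Wrap e₃ → u + o + e₃ ≡ w + (e₁ + e₂) → u + o ≡ w ⊎ u + o ≡ w + N
    cases (inj₁ refl) (inj₁ refl) (inj₁ refl) eq = inj₁ (trans (sym (+-identityʳ _)) (trans eq (+-identityʳ w)))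
    cases (inj₁ refl) (inj₂ refl) (inj₁ refl) eq = inj₂ (trans (sym (+-identityʳ _)) eq)
    cases (inj₂ refl) (inj₁ refl) (inj₁ refl) eq = inj₂ (trans (sym (+-identityʳ _)) (trans eq (cong (w +_) (+-identityʳ N))))
    cases (inj₂ refl) (inj₂ refl) (inj₁ refl) eq = contradiction (begin-strict
      N + N         ≤⟨ m≤n+m (N + N) w ⟩
      w + (N + N)   ≡⟨ trans (sym eq) (+-identityʳ _) ⟩
      u + o         <⟨ +-mono-< (dist<N c a) (dist<N a b) ⟩
      N + N         ∎) (<-irrefl refl)
    cases (inj₁ refl) (inj₁ refl) (inj₂ refl) eq = contradiction (begin-strict
      N             ≤⟨ m≤n+m N (u + o) ⟩
      u + o + N     ≡⟨ trans eq (+-identityʳ w) ⟩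
      w             <⟨ dist<N c b ⟩
      N             ∎) (<-irrefl refl)
    cases (inj₁ refl) (inj₂ refl) (inj₂ refl) eq = inj₁ (+-cancelʳ-≡ N _ _ eq)
    cases (inj₂ refl) (inj₁ refl) (inj₂ refl) eq = inj₁ (+-cancelʳ-≡ N _ _ (trans eq (cong (w +_) (+-identityʳ N))))
    cases (inj₂ refl) (inj₂ refl) (inj₂ refl) eq = inj₂ (+-cancelʳ-≡ N _ _ (trans eq (sym (+-assoc w N N))))

  dist-sym : ∀ {a b} → a ≢ b → dist a b + dist b a ≡ N
  dist-sym {a} {b} a≢b with dist-triangle a b a
  ... | inj₁ e = contradiction (dist≡0⇒≡ (m+n≡0⇒m≡0 _ (trans e (dist-self a)))) a≢b
  ... | inj₂ e = trans e (cong (_+ N) (dist-self a))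

  dist-flip : ∀ {a b} → a ≢ b → dist b a ≡ N ∸ dist a b
  dist-flip {a} {b} a≢b = trans (sym (m+n∸m≡n (dist a b) (dist b a))) (cong (_∸ dist a b) (dist-sym a≢b))

  dist-surjectiveˡ : ∀ j {v} → v < N → ∃ λ i → dist i j ≡ v
  dist-surjectiveˡ j {zero}  _   = j , dist-self j
  dist-surjectiveˡ j {suc v} v<N with dist-surjectiveʳ j (∸-monoʳ-< {N} {suc v} {0} z<s (<⇒≤ v<N))
  ... | i , ji = i , (begin
    dist i j               ≡⟨ dist-flip j≢i ⟩
    N ∸ dist j i           ≡⟨ cong (N ∸_) ji ⟩
    N ∸ (N ∸ suc v)        ≡⟨ m∸[m∸n]≡n (<⇒≤ v<N) ⟩
    suc v                  ∎)
    where
    open ≡-Reasoning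
    j≢i : j ≢ i
    j≢i refl = contradiction (trans (sym ji) (dist-self j)) (m>n⇒m∸n≢0 v<N)

  dist-injectiveˡ : ∀ {i i'} j → dist i j ≡ dist i' j → i ≡ i'
  dist-injectiveˡ {i} {i'} j eq with i ≟ᶠ j | i' ≟ᶠ j
  ... | yes refl | yes refl = refl
  ... | yes refl | no  i'≢j = sym (dist≡0⇒≡ (trans (sym eq) (dist-self i)))
  ... | no  i≢j  | yes refl = dist≡0⇒≡ (trans eq (dist-self i'))
  ... | no  i≢j  | no  i'≢j = dist-injectiveʳ j (trans (dist-flip i≢j) (trans (cong (N ∸_) eq) (sym (dist-flip i'≢j))))

  dist-+-≤ : ∀ c {a x} → dist c a ≤ dist c x → dist c a + dist a x ≡ dist c x
  dist-+-≤ c {a} {x} le with dist-triangle c a x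
  ... | inj₁ e = e
  ... | inj₂ e = contradiction (dist<N a x) (≤⇒≯ (+-cancelˡ-≤ (dist c x) _ _ (begin
    dist c x + N            ≡⟨ e ⟨
    dist c a + dist a x     ≤⟨ +-monoˡ-≤ _ le ⟩
    dist c x + dist a x     ∎)))
    where open ≤-Reasoning

  dist-+-> : ∀ c {a x} → dist c x < dist c a → dist c a + dist a x ≡ dist c x + N
  dist-+-> c {a} {x} lt with dist-triangle c a x
  ... | inj₂ e = e
  ... | inj₁ e = contradiction (subst (dist c a ≤_) e (m≤m+n _ _)) (<⇒≱ lt)

  dist-+-between : ∀ b {a₁ a₂ x} → dist b a₁ ≤ dist b a₂ → dist a₁ x ≤ dist a₁ a₂ →
                   dist b a₁ + dist a₁ x ≡ dist b x
  dist-+-between b {a₁} {a₂} {x} le₁ le₂ with dist-triangle b a₁ x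
  ... | inj₁ e = e
  ... | inj₂ e = contradiction (begin-strict
    N                       ≤⟨ m≤n+m N (dist b x) ⟩
    dist b x + N            ≡⟨ e ⟨
    dist b a₁ + dist a₁ x   ≤⟨ +-monoʳ-≤ (dist b a₁) le₂ ⟩
    dist b a₁ + dist a₁ a₂  ≡⟨ dist-+-≤ b le₁ ⟩
    dist b a₂               <⟨ dist<N b a₂ ⟩
    N                       ∎) (<-irrefl refl)
    where open ≤-Reasoning

  Inc⊎Lt : ∀ a b → Inc n k a b ⊎ Lt n k a b
  Inc⊎Lt a b with incB n k a b
  ... | true  = inj₁ refl
  ... | false = inj₂ refl

  Inc⇒¬Lt : ∀ a b → Inc n k a b → ¬ Lt n k a b
  Inc⇒¬Lt a b inc lt = contradiction (trans (sym inc) lt) λ ()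

  dist≤k⇒Inc : ∀ a b → dist a b ≤ k → Inc n k a b
  dist≤k⇒Inc a b le = subst (λ d → (d ≤ᵇ k) ≡ true) (dist≡offset a b) (≤ᵇ-true le)

  Lt⇒k<dist : ∀ a b → Lt n k a b → k < dist a b
  Lt⇒k<dist a b lt = false-≤ᵇ (subst (λ d → (d ≤ᵇ k) ≡ false) (sym (dist≡offset a b)) lt)

  k<dist⇒Lt : ∀ a b → k < dist a b → Lt n k a b
  k<dist⇒Lt a b lt = subst (λ d → (d ≤ᵇ k) ≡ false) (dist≡offset a b) (≤ᵇ-false lt)

  Window : Fin N → Fin N → Set
  Window b a = 0 < dist b a × dist b a < n

  Lt⇒Window : ∀ a b → Lt n k a b → Window b a
  Lt⇒Window a b lt = ≢⇒dist>0 (a≢b ∘ sym) , ≰⇒> λ n≤dba → <-irrefl refl (begin-strict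
    n + k                ≡⟨ +-comm n k ⟩
    k + n                <⟨ +-mono-<-≤ (Lt⇒k<dist a b lt) n≤dba ⟩
    dist a b + dist b a  ≡⟨ dist-sym a≢b ⟩
    N                    ∎)
    where
    open ≤-Reasoning
    a≢b : a ≢ b
    a≢b refl = contradiction (subst (k <_) (dist-self a) (Lt⇒k<dist a b lt)) λ ()

  Window⇒Lt : ∀ a b → Window b a → Lt n k a b
  Window⇒Lt a b (pos , small) = k<dist⇒Lt a b (≰⇒> λ dab≤k → <-irrefl refl (begin-strict
    N                    ≡⟨ dist-sym a≢b ⟨
    dist a b + dist b a  <⟨ +-mono-≤-< dab≤k small ⟩
    k + n                ≡⟨ +-comm k n ⟩
    N                    ∎))
    where
    open ≤-Reasoning
    a≢b : a ≢ b
    a≢b refl = <-irrefl (sym (dist-self a)) pos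

  interval-count : ∀ c {j} → j < N → count (λ a → dist c a ≤ᵇ j) ≡ suc j
  interval-count c {zero} _ =
    trans (count-insert {P = λ _ → false} c refl (≤ᵇ-true (≤-reflexive (dist-self c))) outside)
          (cong suc (count-none {N} λ _ → refl))
    where
    outside : ∀ a → a ≢ c → false ≡ (dist c a ≤ᵇ 0)
    outside a a≢c = sym (≤ᵇ-false (≢⇒dist>0 (a≢c ∘ sym)))
  interval-count c {suc j} 1+j<N with dist-surjectiveʳ c 1+j<N
  ... | e , ce≡1+j =
    trans (count-insert e (≤ᵇ-false {dist c e} (≤-reflexive (sym ce≡1+j))) (≤ᵇ-true (≤-reflexive ce≡1+j)) agree)
          (cong suc (interval-count c (<⇒≤ 1+j<N)))
    where
    agree : ∀ a → a ≢ e → (dist c a ≤ᵇ j) ≡ (dist c a ≤ᵇ suc j)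
    agree a a≢e = ≤ᵇ-suc λ ca≡1+j → a≢e (dist-injectiveʳ c (trans ca≡1+j (sym ce≡1+j)))

  ↓ : Fin N → Fin N → Bool
  ↓ b a = not (incB n k a b)

  ↓⇒Lt : ∀ b a → ↓ b a ≡ true → Lt n k a b
  ↓⇒Lt b a = not-injective

  Lt⇒↓ : ∀ b a → Lt n k a b → ↓ b a ≡ true
  Lt⇒↓ b a = cong not

  ↓-count : ∀ b → 0 < n → suc (count (↓ b)) ≡ n
  ↓-count b n>0 = begin
    suc (count (↓ b))                   ≡⟨ count-insert b b∉↓b (≤ᵇ-true (≤-trans (≤-reflexive (dist-self b)) z≤n))
                                                        agree ⟨
    count (λ a → dist b a ≤ᵇ (n ∸ 1))   ≡⟨ interval-count b (≤-trans n∸1<n (m≤m+n n k)) ⟩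
    suc (n ∸ 1)                         ≡⟨ m+[n∸m]≡n n>0 ⟩
    n                                   ∎
    where
    open ≡-Reasoning
    b∉↓b : ↓ b b ≡ false
    b∉↓b = cong not (dist≤k⇒Inc b b (≤-trans (≤-reflexive (dist-self b)) z≤n))
    n∸1<n : n ∸ 1 < n
    n∸1<n = ∸-monoʳ-< {n} {1} {0} z<s n>0
    agree : ∀ a → a ≢ b → ↓ b a ≡ (dist b a ≤ᵇ (n ∸ 1))
    agree a a≢b = bool-ext
      (λ a<b → ≤ᵇ-true (<⇒≤∸1 (proj₂ (Lt⇒Window a b (↓⇒Lt b a a<b)))))
      (λ near → Lt⇒↓ b a (Window⇒Lt a b (≢⇒dist>0 (a≢b ∘ sym) , ≤-<-trans (true-≤ᵇ near) n∸1<n)))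

  dist-step : ∀ b {e e'} → dist b e' ≡ suc (dist b e) → dist e e' ≡ 1
  dist-step b {e} {e'} be'≡1+be = +-cancelˡ-≡ (dist b e) _ _
    (trans (dist-+-≤ b (≤-trans (n≤1+n _) (≤-reflexive (sym be'≡1+be)))) (trans be'≡1+be (+-comm 1 (dist b e))))

  dist-successor : ∀ y {e e'} → dist e e' ≡ 1 → dist y e' ≡ suc (dist y e) ⊎ e' ≡ y
  dist-successor y {e} {e'} ee'≡1 with dist-triangle y e e'
  ... | inj₁ eq = inj₁ (trans (sym eq) (trans (cong (dist y e +_) ee'≡1) (+-comm (dist y e) 1)))
  ... | inj₂ eq = inj₂ (sym (dist≡0⇒≡ (n≤0⇒n≡0 (+-cancelʳ-≤ N _ 0 (begin
    dist y e' + N        ≡⟨ eq ⟨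
    dist y e + dist e e' ≡⟨ trans (cong (dist y e +_) ee'≡1) (+-comm (dist y e) 1) ⟩
    suc (dist y e)       ≤⟨ dist<N y e ⟩
    N                    ∎)))))
    where open ≤-Reasoning

  Contiguous-resp : ∀ {P P' : Fin N → Set} → (∀ a → P a → P' a) → (∀ a → P' a → P a) →
                    Contiguous n k P → Contiguous n k P'
  Contiguous-resp P⇒P' P'⇒P (inj₁ empty)          = inj₁ λ a p' → empty a (P'⇒P a p')
  Contiguous-resp P⇒P' P'⇒P (inj₂ (i , r , block)) =
    inj₂ (i , r , λ a → mk⇔ (Equivalence.to (block a) ∘ P'⇒P a) (P⇒P' a ∘ Equivalence.from (block a)))

  Block : Fin N → ℕ → (Fin N → Set) → Set
  Block c j P = ∀ a → P a ⇔ dist c a < j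

  private
    ⇔-dist⇒offset : ∀ {A : Set} {c a r} → A ⇔ dist c a ≤ r → A ⇔ offset n k c a ≤ r
    ⇔-dist⇒offset {c = c} {a} {r} = subst (λ d → _ ⇔ d ≤ r) (dist≡offset c a)

    ⇔-offset⇒dist : ∀ {A : Set} {c a r} → A ⇔ offset n k c a ≤ r → A ⇔ dist c a ≤ r
    ⇔-offset⇒dist {c = c} {a} {r} = subst (λ d → _ ⇔ d ≤ r) (sym (dist≡offset c a))

  Block⇒Contiguous : ∀ {c j P} → 0 < j → Block c j P → Contiguous n k P
  Block⇒Contiguous {c} {j} j>0 block = inj₂ (c , j ∸ 1 , λ a → ⇔-dist⇒offset {c = c} {a} (mk⇔
    (λ Pa → ≤-pred (≤-trans (Equivalence.to (block a) Pa) (≤-reflexive (sym (m+[n∸m]≡n j>0)))))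
    (λ ca≤j-1 → Equivalence.from (block a) (≤-trans (s≤s ca≤j-1) (≤-reflexive (m+[n∸m]≡n j>0))))))

  Contiguous⇒Block : ∀ {P : Fin N → Bool} {j} → Contiguous n k (λ a → P a ≡ true) → count P ≡ j → 0 < j → j < N →
                     ∃ λ c → Block c j (λ a → P a ≡ true)
  Contiguous⇒Block (inj₁ empty) count≡j j>0 j<N =
    contradiction (trans (sym count≡j) (count-none λ a → ¬-not (empty a))) (>⇒≢ j>0)
  Contiguous⇒Block {P} {j} (inj₂ (c , r , block′)) count≡j j>0 j<N =
    c , λ a → mk⇔ (λ Pa → subst (dist c a <_) 1+r≡j (s≤s (Equivalence.to (block a) Pa)))
                  (λ ca<j → Equivalence.from (block a) (≤-pred (subst (dist c a <_) (sym 1+r≡j) ca<j)))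
    where
    block : ∀ a → P a ≡ true ⇔ dist c a ≤ r
    block a = ⇔-offset⇒dist {c = c} {a} (block′ a)
    r<N : r < N
    r<N = ≰⇒> λ N≤r → >⇒≢ j<N (trans (sym (count-all λ a → Equivalence.from (block a) (≤-trans (<⇒≤ (dist<N c a)) N≤r)))
                                       count≡j)
    1+r≡j : suc r ≡ j
    1+r≡j = trans (sym (interval-count c r<N)) (trans (count-cong λ a → bool-ext
              (Equivalence.from (block a) ∘ true-≤ᵇ {dist c a} {r}) (≤ᵇ-true ∘ Equivalence.to (block a))) count≡j)

  block-extendʳ : ∀ {c j y P} → Block c j P → dist c y ≡ j → Block c (suc j) (λ a → P a ⊎ a ≡ y)
  block-extendʳ {c} {j} {y} {P} block cy≡j a = mk⇔ to from
    where
    to : P a ⊎ a ≡ y → dist c a < suc j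
    to (inj₁ Pa)   = m<n⇒m<1+n (Equivalence.to (block a) Pa)
    to (inj₂ refl) = s≤s (≤-reflexive cy≡j)
    from : dist c a < suc j → P a ⊎ a ≡ y
    from ca<1+j with dist c a <? j
    ... | yes ca<j = inj₁ (Equivalence.from (block a) ca<j)
    ... | no  ca≮j = inj₂ (dist-injectiveʳ c (trans (≤-antisym (≤-pred ca<1+j) (≮⇒≥ ca≮j)) (sym cy≡j)))

  dist-shift : ∀ {c y a} → dist c y ≡ N ∸ 1 → a ≢ y → dist y a ≡ suc (dist c a)
  dist-shift {c} {y} {a} cy≡N-1 a≢y = shift (dist-triangle y c a)
    where
    c≢y : c ≢ y
    c≢y refl = a≢y (toℕ-injective (trans (n<1⇒n≡0 (≤-trans (toℕ<n a) N≤1))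
                                         (sym (n<1⇒n≡0 (≤-trans (toℕ<n c) N≤1)))))
      where
      N≤1 : N ≤ 1
      N≤1 = m∸n≡0⇒m≤n (trans (sym cy≡N-1) (dist-self c))
    yc≡1 : dist y c ≡ 1
    yc≡1 = trans (dist-flip c≢y) (trans (cong (N ∸_) cy≡N-1) (m∸[m∸n]≡n (≤-trans (s≤s z≤n) (toℕ<n c))))
    shift : dist y c + dist c a ≡ dist y a ⊎ dist y c + dist c a ≡ dist y a + N → dist y a ≡ suc (dist c a)
    shift (inj₁ eq) = trans (sym eq) (cong (_+ dist c a) yc≡1)
    shift (inj₂ eq) = contradiction (dist-injectiveʳ c (trans (≤-antisym (<⇒≤∸1 (dist<N c a)) N-1≤ca) (sym cy≡N-1))) a≢y
      where
      N-1≤ca : N ∸ 1 ≤ dist c a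
      N-1≤ca = ∸-monoˡ-≤ 1 (≤-trans (m≤n+m N (dist y a)) (≤-reflexive (trans (sym eq) (cong (_+ dist c a) yc≡1))))

  block-extendˡ : ∀ {c j y P} → Block c j P → j < N → dist c y ≡ N ∸ 1 → Block y (suc j) (λ a → P a ⊎ a ≡ y)
  block-extendˡ {c} {j} {y} {P} block j<N cy≡N-1 a = mk⇔ to from
    where
    to : P a ⊎ a ≡ y → dist y a < suc j
    to (inj₂ refl) = s≤s (≤-trans (≤-reflexive (dist-self a)) z≤n)
    to (inj₁ Pa)   = subst (_< suc j) (sym (dist-shift cy≡N-1 a≢y)) (s≤s ca<j)
      where
      ca<j : dist c a < j
      ca<j = Equivalence.to (block a) Pa
      a≢y : a ≢ y
      a≢y refl = <-irrefl refl (<-≤-trans ca<j (≤-trans (<⇒≤∸1 j<N) (≤-reflexive (sym cy≡N-1))))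
    from : dist y a < suc j → P a ⊎ a ≡ y
    from ya<1+j with a ≟ᶠ y
    ... | yes a≡y = inj₂ a≡y
    ... | no  a≢y = inj₁ (Equivalence.from (block a) (≤-pred (subst (_< suc j) (dist-shift cy≡N-1 a≢y) ya<1+j)))

  window-convex : ∀ {b p q x} → Lt n k p b → Lt n k q b → dist b p ≤ dist b q → dist p x ≤ dist p q → Lt n k x b
  window-convex {b} {p} {q} {x} p<b q<b bp≤bq px≤pq = Window⇒Lt x b
    ( <-≤-trans (proj₁ (Lt⇒Window p b p<b)) (subst (dist b p ≤_) bx (m≤m+n _ _))
    , ≤-<-trans (subst₂ _≤_ bx bq (+-monoʳ-≤ (dist b p) px≤pq)) (proj₂ (Lt⇒Window q b q<b)) )
    where
    bx : dist b p + dist p x ≡ dist b x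
    bx = dist-+-between b bp≤bq px≤pq
    bq : dist b p + dist p q ≡ dist b q
    bq = dist-+-between b bp≤bq ≤-refl

  window-between : ∀ {b c a₁ a₂ x} → Lt n k a₁ b → Lt n k a₂ b → dist c a₁ < dist c x → dist c x < dist c a₂ →
                   Lt n k x b ⊎ Lt n k c b
  window-between {b} {c} {a₁} {a₂} {x} a₁<b a₂<b ca₁<cx cx<ca₂ with dist b a₁ ≤? dist b a₂
  ... | yes ba₁≤ba₂ = inj₁ (window-convex a₁<b a₂<b ba₁≤ba₂ (+-cancelˡ-≤ (dist c a₁) _ _ (begin
    dist c a₁ + dist a₁ x   ≡⟨ dist-+-≤ c (<⇒≤ ca₁<cx) ⟩
    dist c x                ≤⟨ <⇒≤ cx<ca₂ ⟩
    dist c a₂               ≡⟨ dist-+-≤ c (<⇒≤ (<-trans ca₁<cx cx<ca₂)) ⟨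
    dist c a₁ + dist a₁ a₂  ∎)))
    where open ≤-Reasoning
  ... | no  ba₁≰ba₂ = inj₂ (window-convex a₂<b a₁<b (<⇒≤ (≰⇒> ba₁≰ba₂)) (+-cancelˡ-≤ (dist c a₂) _ _ (begin
    dist c a₂ + dist a₂ c   ≡⟨ dist-+-> c (subst (_< dist c a₂) (sym (dist-self c)) (≤-<-trans z≤n cx<ca₂)) ⟩
    dist c c + N            ≤⟨ +-monoˡ-≤ N (≤-trans (≤-reflexive (dist-self c)) (z≤n {dist c a₁})) ⟩
    dist c a₁ + N           ≡⟨ dist-+-> c (<-trans ca₁<cx cx<ca₂) ⟨
    dist c a₂ + dist a₂ a₁  ∎)))
    where open ≤-Reasoning

  card≡sum : ∀ S → card n k S ≡ sum (λ a → count (S a))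
  card≡sum S = trans (sum-allFin (λ a → List.sum (map (λ b → ⟦ S a b ⟧) (allFin N))))
                     (sum-cong-≗ λ a → sum-allFin (λ b → ⟦ S a b ⟧))

  card-cong : ∀ {S T} → (∀ a b → S a b ≡ T a b) → card n k S ≡ card n k T
  card-cong {S} {T} S≗T = trans (card≡sum S) (trans (sum-cong-≗ λ a → count-cong (S≗T a)) (sym (card≡sum T)))

  InT-applyUpTo⁻ : ∀ f d {a b} → InT n k (applyUpTo f d) a b →
                   ∃ λ t → t < d × a ≡ f t × (∀ u → u ≤ t → Inc n k (f u) b)
  InT-applyUpTo⁻ f (suc d) (inc , inj₁ refl) = 0 , z<s , refl , λ { zero _ → inc }
  InT-applyUpTo⁻ f (suc d) (inc , inj₂ rest) with InT-applyUpTo⁻ (λ t → f (suc t)) d rest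
  ... | t , t<d , refl , incs = suc t , s≤s t<d , refl , λ { zero _ → inc ; (suc u) (s≤s u≤t) → incs u u≤t }

  InT-applyUpTo⁺ : ∀ f d {a b} t → t < d → a ≡ f t → (∀ u → u ≤ t → Inc n k (f u) b) → InT n k (applyUpTo f d) a b
  InT-applyUpTo⁺ f (suc d) zero    _         refl incs = incs 0 z≤n , inj₁ refl
  InT-applyUpTo⁺ f (suc d) (suc t) (s≤s t<d) refl incs =
    incs 0 z≤n , inj₂ (InT-applyUpTo⁺ (λ t → f (suc t)) d t t<d refl λ u u≤t → incs (suc u) (s≤s u≤t))

  -- Pairs reversed by a ranking of A

  Ranking : Set
  Ranking = Fin N → ℕ

  Reversed : Ranking → Fin N → Fin N → Set
  Reversed r a b = ∀ a' → r a ≤ r a' → Inc n k a' b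

  reversed? : ∀ r a b → Dec (Reversed r a b)
  reversed? r a b = all? λ a' → (r a ≤? r a') →-dec (incB n k a' b ≟ᵇ true)

  reversedSet : Ranking → SubPairs n k
  reversedSet r a b = ⌊ reversed? r a b ⌋

  ∈reversedSet⇒ : ∀ {r a b} → reversedSet r a b ≡ true → Reversed r a b
  ∈reversedSet⇒ {r} {a} {b} eq with reversed? r a b
  ... | yes rev = rev

  ⇒∈reversedSet : ∀ {r a b} → Reversed r a b → reversedSet r a b ≡ true
  ⇒∈reversedSet {r} {a} {b} rev with reversed? r a b
  ... | yes _    = refl
  ... | no ¬rev = contradiction rev ¬rev

  Reversed⇒Inc : ∀ {r a b} → Reversed r a b → Inc n k a b
  Reversed⇒Inc {a = a} rev = rev a ≤-refl

  ceiling : Ranking → Fin N → ℕ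
  ceiling r b = max 0 (tabulate λ a → if incB n k a b then 0 else suc (r a))

  ceiling-above : ∀ r {a b} → Lt n k a b → r a < ceiling r b
  ceiling-above r {a} {b} lt = subst (λ x → (if x then 0 else suc (r a)) ≤ ceiling r b) lt
    (lookup (xs≤max 0 _) (∈-tabulate⁺ a))

  ceiling-below : ∀ r {a b} → Reversed r a b → ceiling r b ≤ r a
  ceiling-below r {a} {b} rev = max≤v⁺ z≤n (tabulate⁺ bound)
    where
    bound : ∀ a' → (if incB n k a' b then 0 else suc (r a')) ≤ r a
    bound a' with incB n k a' b in eq
    ... | true  = z≤n
    ... | false = ≰⇒> λ ra≤ra' → Inc⇒¬Lt a' b (rev a' ra≤ra') eq

  module _ (r : Ranking) (r-injective : Injective _≡_ _≡_ r) where

    -- b is placed above every a < b and below every a reversing it; the residue modulo M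
    -- tells the a's from the b's.
    private
      M : ℕ
      M = suc N

      rank : Elem n k → ℕ
      rank (inj₁ a) = r a * M + N
      rank (inj₂ b) = ceiling r b * M + toℕ b

      rank-mod : Elem n k → ℕ
      rank-mod (inj₁ a) = N
      rank-mod (inj₂ b) = toℕ b

      rank%M : ∀ x → rank x % M ≡ rank-mod x
      rank%M (inj₁ a) = trans (cong (_% M) (+-comm (r a * M) N))
                              (trans ([m+kn]%n≡m%n N (r a) M) (m<n⇒m%n≡m ≤-refl))
      rank%M (inj₂ b) = trans (cong (_% M) (+-comm (ceiling r b * M) (toℕ b)))
                              (trans ([m+kn]%n≡m%n (toℕ b) (ceiling r b) M) (m<n⇒m%n≡m (m≤n⇒m≤1+n (toℕ<n b))))

      rank-injective : Injective _≡_ _≡_ rank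
      rank-injective {inj₁ a} {inj₁ a'} eq = cong inj₁ (r-injective (*-cancelʳ-≡ (r a) (r a') M (+-cancelʳ-≡ N _ _ eq)))
      rank-injective {inj₁ a} {inj₂ b} eq =
        contradiction (trans (sym (rank%M (inj₁ a))) (trans (cong (_% M) eq) (rank%M (inj₂ b)))) (<⇒≢ (toℕ<n b) ∘ sym)
      rank-injective {inj₂ b} {inj₁ a} eq =
        contradiction (trans (sym (rank%M (inj₁ a))) (trans (cong (_% M) (sym eq)) (rank%M (inj₂ b)))) (<⇒≢ (toℕ<n b) ∘ sym)
      rank-injective {inj₂ b} {inj₂ b'} eq =
        cong inj₂ (toℕ-injective (trans (sym (rank%M (inj₂ b))) (trans (cong (_% M) eq) (rank%M (inj₂ b')))))

      rank-monotone : ∀ a b → Lt n k a b → rank (inj₁ a) < rank (inj₂ b)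
      rank-monotone a b lt = begin-strict
        r a * M + N           <⟨ +-monoʳ-< (r a * M) ≤-refl ⟩
        r a * M + M           ≡⟨ +-comm (r a * M) M ⟩
        suc (r a) * M         ≤⟨ *-monoˡ-≤ M (ceiling-above r lt) ⟩
        ceiling r b * M       ≤⟨ m≤m+n (ceiling r b * M) (toℕ b) ⟩
        ceiling r b * M + toℕ b ∎
        where open ≤-Reasoning

      rank-reverses : ∀ {a b} → Reversed r a b → rank (inj₂ b) < rank (inj₁ a)
      rank-reverses {a} {b} rev = begin-strict
        ceiling r b * M + toℕ b <⟨ +-monoʳ-< (ceiling r b * M) (toℕ<n b) ⟩
        ceiling r b * M + N     ≤⟨ +-monoˡ-≤ N (*-monoˡ-≤ M (ceiling-below r rev)) ⟩
        r a * M + N             ∎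
        where open ≤-Reasoning

    extension : LinearExtension n k
    extension = record { rank = rank ; injective = rank-injective ; monotone = rank-monotone }

    reversedSet-reversible : Reversible n k (reversedSet r)
    reversedSet-reversible = (λ a b → Reversed⇒Inc ∘ ∈reversedSet⇒) , extension , λ a b → rank-reverses ∘ ∈reversedSet⇒

  record Representation (S : SubPairs n k) : Set where
    field
      r           : Ranking
      r-injective : Injective _≡_ _≡_ r
      sound       : ∀ a b → S a b ≡ true → Reversed r a b
      complete    : ∀ a b → Reversed r a b → S a b ≡ true

  reversible⇒⊆reversed : ∀ {S} (R : Reversible n k S) → let L = proj₁ (proj₂ R) in
                         ∀ a b → S a b ≡ true → Reversed (λ x → LinearExtension.rank L (inj₁ x)) a b
  reversible⇒⊆reversed (_ , L , reverses) a b ab∈S a' ra≤ra' with Inc⊎Lt a' b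
  ... | inj₁ inc = inc
  ... | inj₂ lt  = contradiction (≤-trans (monotone a' b lt) (<⇒≤ (<-≤-trans (reverses a b ab∈S) ra≤ra'))) (<-irrefl refl)
    where open LinearExtension L

  maximal⇒representation : ∀ {S} → MaximalReversible n k S → Representation S
  maximal⇒representation {S} (R@(_ , L , _) , maximal) = record
    { r           = r
    ; r-injective = r-injective
    ; sound       = reversible⇒⊆reversed R
    ; complete    = λ a b rev → maximal (reversedSet r) (reversedSet-reversible r r-injective)
                      (λ a b → ⇒∈reversedSet ∘ reversible⇒⊆reversed R a b) a b (⇒∈reversedSet rev)
    }
    where
    r : Ranking
    r x = LinearExtension.rank L (inj₁ x)
    r-injective : Injective _≡_ _≡_ r
    r-injective eq with LinearExtension.injective L eq
    ... | refl = refl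

  maximal-absorbs : ∀ {S} → MaximalReversible n k S → (R : Representation S) → ∀ r' → Injective _≡_ _≡_ r' →
                    (∀ a b → Reversed (Representation.r R) a b → Reversed r' a b) →
                    ∀ a b → Reversed r' a b → S a b ≡ true
  maximal-absorbs (_ , maximal) R r' r'-injective grows a b rev' =
    maximal (reversedSet r') (reversedSet-reversible r' r'-injective)
      (λ a b → ⇒∈reversedSet ∘ grows a b ∘ Representation.sound R a b) a b (⇒∈reversedSet rev')

  -- Moves a to just above c; doubling the other ranks makes room.
  raise : Ranking → Fin N → Fin N → Ranking
  raise r a c x with x ≟ᶠ a
  ... | yes _ = suc (2 * r c)
  ... | no  _ = 2 * r x

  module _ (r : Ranking) (a c : Fin N) where

    raise-self : raise r a c a ≡ suc (2 * r c)
    raise-self with a ≟ᶠ a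
    ... | yes _   = refl
    ... | no  a≢a = contradiction refl a≢a

    raise-other : ∀ {x} → x ≢ a → raise r a c x ≡ 2 * r x
    raise-other {x} x≢a with x ≟ᶠ a
    ... | yes x≡a = contradiction x≡a x≢a
    ... | no  _   = refl

    raise-injective : Injective _≡_ _≡_ r → Injective _≡_ _≡_ (raise r a c)
    raise-injective r-injective {x} {y} eq with x ≟ᶠ a | y ≟ᶠ a
    ... | yes x≡a | yes y≡a = trans x≡a (sym y≡a)
    ... | yes _   | no  _   = contradiction (sym eq) (even≢odd (r y) (r c))
    ... | no  _   | yes _   = contradiction eq (even≢odd (r x) (r c))
    ... | no  _   | no  _   = r-injective (*-cancelˡ-≡ (r x) (r y) 2 eq)

    raise-≤-other : ∀ {x y} → x ≢ a → y ≢ a → raise r a c x ≤ raise r a c y → r x ≤ r y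
    raise-≤-other x≢a y≢a le = *-cancelˡ-≤ 2 (subst₂ _≤_ (raise-other x≢a) (raise-other y≢a) le)

    raise-self-≤ : ∀ {y} → y ≢ a → raise r a c a ≤ raise r a c y → r c < r y
    raise-self-≤ y≢a le = ≰⇒> λ ry≤rc →
      <-irrefl refl (<-≤-trans (subst₂ _≤_ raise-self (raise-other y≢a) le) (*-monoʳ-≤ 2 ry≤rc))

    raise-≤-self : ∀ {x} → x ≢ a → raise r a c x ≤ raise r a c a → r x ≤ r c
    raise-≤-self x≢a le = half (subst₂ _≤_ (raise-other x≢a) raise-self le)
      where
      half : ∀ {u v} → 2 * u ≤ suc (2 * v) → u ≤ v
      half {u} {v} le = ≮⇒≥ λ v<u → 1+n≰n (≤-trans (≤-trans (≤-reflexive (sym (*-suc 2 v))) (*-monoʳ-≤ 2 v<u)) le)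

    raise-reversed : r a < r c → (∀ b → Reversed r c b → Inc n k a b) →
                     ∀ x y → Reversed r x y → Reversed (raise r a c) x y
    raise-reversed ra<rc c⇒a x y rev x' le = cases (x ≟ᶠ a) (x' ≟ᶠ a)
      where
      cases : Dec (x ≡ a) → Dec (x' ≡ a) → Inc n k x' y
      cases (yes refl) (yes refl) = rev x ≤-refl
      cases (yes refl) (no x'≢a)  = rev x' (<⇒≤ (<-trans ra<rc (raise-self-≤ x'≢a le)))
      cases (no x≢a)   (yes refl) = c⇒a y λ x'' rc≤rx'' → rev x'' (≤-trans (raise-≤-self x≢a le) rc≤rx'')
      cases (no x≢a)   (no x'≢a)  = rev x' (raise-≤-other x≢a x'≢a le)

  reversible⇒independent : ∀ {S} → Reversible n k S → Independent n k S
  reversible⇒independent (inc , L , reverses) = inc , λ i j x y ij∈S xy∈S (i<y , x<j) →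
    <-irrefl refl (<-trans (reverses i j ij∈S) (<-trans (monotone i y i<y) (<-trans (reverses x y xy∈S) (monotone x j x<j))))
    where open LinearExtension L

  raise-above-top : ∀ r {a b c} → Inc n k a b → (∀ x → Lt n k x b → r x ≤ r c) → Reversed (raise r a c) a b
  raise-above-top r {a} {b} {c} ab-inc c-top x le = cases (x ≟ᶠ a) (Inc⊎Lt x b)
    where
    cases : Dec (x ≡ a) → Inc n k x b ⊎ Lt n k x b → Inc n k x b
    cases (yes refl) _          = ab-inc
    cases (no _)     (inj₁ inc) = inc
    cases (no x≢a)   (inj₂ x<b) = contradiction (c-top x x<b) (<⇒≱ (raise-self-≤ r a c x≢a le))

  -- Some b reversed by z lies above y, so y cannot be moved just above z.
  Obstructs : Ranking → Fin N → Fin N → Set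
  Obstructs r z y = ∃ λ b → Reversed r z b × Lt n k y b

  obstructs? : ∀ r z y → Dec (Obstructs r z y)
  obstructs? r z y = any? λ b → reversed? r z b ×-dec (incB n k y b ≟ᵇ false)

  ¬obstructs⇒Inc : ∀ {r z y} → ¬ Obstructs r z y → ∀ b → Reversed r z b → Inc n k y b
  ¬obstructs⇒Inc {y = y} free b z-b with Inc⊎Lt y b
  ... | inj₁ inc = inc
  ... | inj₂ y<b = contradiction (b , z-b , y<b) free

  ¬reversed⇒witness : ∀ r {a b} → ¬ Reversed r a b → ∃ λ a' → r a ≤ r a' × Lt n k a' b
  ¬reversed⇒witness r {a} {b} ¬rev with ¬∀⟶∃¬ N _ (λ a' → (r a ≤? r a') →-dec (incB n k a' b ≟ᵇ true)) ¬rev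
  ... | a' , ¬inc with r a ≤? r a' | Inc⊎Lt a' b
  ...   | yes le | inj₂ lt  = a' , le , lt
  ...   | yes le | inj₁ inc = contradiction (λ _ → inc) ¬inc
  ...   | no ¬le | _        = contradiction (λ le → contradiction le ¬le) ¬inc

  maximalReversible⇒maximalIndependent : ∀ {S} → MaximalReversible n k S → MaximalIndependent n k S
  maximalReversible⇒maximalIndependent {S} maximal@(reversible , _) =
    reversible⇒independent reversible , closed
    where
    open Representation (maximal⇒representation maximal)
    closed : ∀ T → Independent n k T → (∀ a b → S a b ≡ true → T a b ≡ true) →
             ∀ a b → T a b ≡ true → S a b ≡ true
    closed T (T-inc , T-indep) S⊆T a b ab∈T with reversed? r a b
    ... | yes rev  = complete a b rev
    ... | no  ¬rev with ¬reversed⇒witness r ¬rev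
    ...   | a' , ra≤ra' , a'<b with argmax-exists (λ x → incB n k x b ≟ᵇ false) r {a'} a'<b
    ...     | c , c<b , c-top with obstructs? r c a
    ...       | yes (y , cy-rev , a<y) = contradiction (a<y , c<b) (T-indep a b c y ab∈T (S⊆T c y (complete c y cy-rev)))
    ...       | no  free = maximal-absorbs maximal (maximal⇒representation maximal) (raise r a c)
                             (raise-injective r a c r-injective) (raise-reversed r a c ra<rc (¬obstructs⇒Inc {r} {c} {a} free))
                             a b (raise-above-top r (T-inc a b ab∈T) c-top)
      where
      ra<rc : r a < r c
      ra<rc = ≤∧≢⇒< (≤-trans ra≤ra' (c-top a' a'<b))
                    λ eq → Inc⇒¬Lt c b (subst (λ z → Inc n k z b) (r-injective eq) (T-inc a b ab∈T)) c<b

  -- Covered windows and levels of a ranking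

  module Windows (n≥2 : 2 ≤ n) where

    Covers : (Fin N → Bool) → Fin N → Set
    Covers Q b = ↓ b ⊆ᵇ Q

    covers? : ∀ Q b → Dec (Covers Q b)
    covers? Q b = all? λ a → (↓ b a ≟ᵇ true) →-dec (Q a ≟ᵇ true)

    covered : (Fin N → Bool) → Fin N → Bool
    covered Q b = ⌊ covers? Q b ⌋

    covered⇒ : ∀ {Q b} → covered Q b ≡ true → Covers Q b
    covered⇒ {Q} {b} eq with covers? Q b
    ... | yes cov = cov

    ⇒covered : ∀ {Q b} → Covers Q b → covered Q b ≡ true
    ⇒covered {Q} {b} cov with covers? Q b
    ... | yes _    = refl
    ... | no ¬cov = contradiction cov ¬cov

    ¬covers⇒uncovered : ∀ {Q b} → ¬ Covers Q b → covered Q b ≡ false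
    ¬covers⇒uncovered {Q} {b} ¬cov with covers? Q b
    ... | yes cov = contradiction cov ¬cov
    ... | no _    = refl

    coverCount : (Fin N → Bool) → ℕ
    coverCount Q = count (covered Q)

    covered-mono : ∀ {P Q} → P ⊆ᵇ Q → covered P ⊆ᵇ covered Q
    covered-mono P⊆Q b = ⇒covered ∘ (λ cov a → P⊆Q a ∘ cov a) ∘ covered⇒

    coverCount-cong : ∀ {P Q} → (∀ a → P a ≡ Q a) → coverCount P ≡ coverCount Q
    coverCount-cong P≗Q = count-cong λ b → bool-ext
      (covered-mono (λ a → subst (_≡ true) (P≗Q a)) b) (covered-mono (λ a → subst (_≡ true) (sym (P≗Q a))) b)

    ↓-inhabited : ∀ b → ∃ λ a → ↓ b a ≡ true
    ↓-inhabited b with dist-surjectiveʳ b {1} (≤-trans n≥2 (m≤m+n n k))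
    ... | a , ba≡1 = a , Lt⇒↓ b a (Window⇒Lt a b (subst (0 <_) (sym ba≡1) z<s , subst (_< n) (sym ba≡1) n≥2))

    covers⇒count : ∀ {Q b} → Covers Q b → n ∸ 1 ≤ count Q
    covers⇒count {Q} {b} cov = subst (_≤ count Q) (cong (_∸ 1) (↓-count b (≤-trans z<s n≥2))) (count-mono cov)

    coverCount-pos : ∀ Q → 0 < coverCount Q → n ∸ 1 ≤ count Q
    coverCount-pos Q pos with count-pos (covered Q) pos
    ... | b , b-covered = covers⇒count (covered⇒ b-covered)

    private
      step-arith : ∀ {c₀ c₁ s m} → c₀ ≤ s ∸ m → c₁ ≤ suc c₀ → (0 < c₁ → m ≤ s) → c₁ ≤ suc s ∸ m
      step-arith {c₁ = zero}  _   _   _   = z≤n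
      step-arith {c₀} {suc _} {s} {m} c₀≤ c₁≤ pos =
        ≤-trans c₁≤ (subst (suc c₀ ≤_) (sym (+-∸-assoc 1 (pos z<s))) (s≤s c₀≤))

    module _ (Q : Fin N → Bool) (y : Fin N) (y∉Q : Q y ≡ false) where

      private
        near : ℕ → Fin N → Bool
        near R a = Q a ∧ (dist y a ≤ᵇ R)

        near-agree : ∀ R e → dist y e ≡ suc R → ∀ a → a ≢ e → near R a ≡ near (suc R) a
        near-agree R e ye≡1+R a a≢e =
          cong (Q a ∧_) (≤ᵇ-suc λ ya≡1+R → a≢e (dist-injectiveʳ y (trans ya≡1+R (sym ye≡1+R))))

        far⇒¬near : ∀ {R a} → R < dist y a → near R a ≡ false
        far⇒¬near {R} {a} lt = trans (cong (Q a ∧_) (≤ᵇ-false lt)) (∧-zeroʳ (Q a))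

        near-zero : ∀ a → near 0 a ≡ false
        near-zero a with a ≟ᶠ y
        ... | yes refl = cong (_∧ _) y∉Q
        ... | no  a≢y  = far⇒¬near (≢⇒dist>0 (a≢y ∘ sym))

        nothing-covered : coverCount (near 0) ≡ 0
        nothing-covered = count-none λ b → ¬covers⇒uncovered λ cov →
          let a , a∈↓b = ↓-inhabited b in contradiction (trans (sym (cov a a∈↓b)) (near-zero a)) λ ()

        window-end : ∀ R {e b} → dist y e ≡ suc R → Lt n k e b → Covers (near (suc R)) b → dist b e ≡ n ∸ 1
        window-end R {e} {b} ye≡1+R e<b cov = decide (dist b e ≟ n ∸ 1)
          where
          decide : Dec (dist b e ≡ n ∸ 1) → dist b e ≡ n ∸ 1
          decide (yes be≡n-1) = be≡n-1
          decide (no  be≢n-1) = next (dist-surjectiveʳ b (≤-trans 2+be≤n (m≤m+n n k)))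
            where
            2+be≤n : suc (dist b e) < n
            2+be≤n = ≤∧≢⇒< (proj₂ (Lt⇒Window e b e<b)) λ eq → be≢n-1 (cong (_∸ 1) eq)
            next : (∃ λ e' → dist b e' ≡ suc (dist b e)) → dist b e ≡ n ∸ 1
            next (e' , be'≡1+be) = contradiction (cov e' e'∈↓b) (e'∉near (dist-successor y (dist-step b be'≡1+be)))
              where
              e'∈↓b : ↓ b e' ≡ true
              e'∈↓b = Lt⇒↓ b e' (Window⇒Lt e' b (subst (0 <_) (sym be'≡1+be) z<s , subst (_< n) (sym be'≡1+be) 2+be≤n))
              e'∉near : dist y e' ≡ suc (dist y e) ⊎ e' ≡ y → near (suc R) e' ≢ true
              e'∉near (inj₁ ye'≡1+ye) near-e' =
                contradiction (trans (sym near-e') (far⇒¬near (≤-reflexive (sym (trans ye'≡1+ye (cong suc ye≡1+R)))))) λ ()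
              e'∉near (inj₂ refl)     near-y  = contradiction (trans (sym near-y) (cong (_∧ _) y∉Q)) λ ()

        cover-step : ∀ R → suc R < N → coverCount (near R) ≤ count (near R) ∸ (n ∸ 2) →
                     coverCount (near (suc R)) ≤ count (near (suc R)) ∸ (n ∸ 2)
        cover-step R 1+R<N ih with dist-surjectiveʳ y 1+R<N
        ... | e , ye≡1+R with Q e in Qe
        ...   | false = subst₂ (λ c s → c ≤ s ∸ (n ∸ 2)) (coverCount-cong same) (count-cong same) ih
          where
          same : ∀ a → near R a ≡ near (suc R) a
          same a with a ≟ᶠ e
          ... | yes refl = trans (cong (_∧ _) Qe) (sym (cong (_∧ _) Qe))
          ... | no  a≢e  = near-agree R e ye≡1+R a a≢e
        ...   | true = subst (λ s → coverCount (near (suc R)) ≤ s ∸ (n ∸ 2)) (sym grows) (step-arith ih covers-grow enough)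
          where
          e∈near : near (suc R) e ≡ true
          e∈near = cong₂ _∧_ Qe (≤ᵇ-true (≤-reflexive ye≡1+R))
          grows : count (near (suc R)) ≡ suc (count (near R))
          grows = count-insert e (far⇒¬near (≤-reflexive (sym ye≡1+R))) e∈near (near-agree R e ye≡1+R)
          b*-spec = dist-surjectiveˡ e {n ∸ 1} (≤-trans (∸-monoʳ-< {n} {1} {0} z<s (≤-trans (s≤s z≤n) n≥2)) (m≤m+n n k))
          b* = proj₁ b*-spec
          only-b* : ∀ b → b ≢ b* → covered (near (suc R)) b ≡ true → covered (near R) b ≡ true
          only-b* b b≢b* b-covered = ⇒covered covers
            where
            covers : Covers (near R) b
            covers a a∈↓b with a ≟ᶠ e
            ... | yes refl = contradiction (dist-injectiveˡ a (trans (window-end R ye≡1+R (↓⇒Lt b a a∈↓b) (covered⇒ b-covered))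
                                                                      (sym (proj₂ b*-spec)))) b≢b*
            ... | no  a≢e  = trans (near-agree R e ye≡1+R a a≢e) (covered⇒ b-covered a a∈↓b)
          covers-grow : coverCount (near (suc R)) ≤ suc (coverCount (near R))
          covers-grow = count-⊆-insert b* only-b*
          enough : 0 < coverCount (near (suc R)) → n ∸ 2 ≤ count (near R)
          enough pos = ≤-pred (subst₂ _≤_ (+-∸-assoc 1 n≥2) grows (coverCount-pos (near (suc R)) pos))

      -- Cut the cycle at y and add the elements of Q by distance from y: a window becomes covered only when
      -- its last element arrives, so each element covers at most one new window, and none before the
      -- first n − 1 elements are present.
      coverCount-bound : coverCount Q ≤ count Q ∸ (n ∸ 2)
      coverCount-bound = subst₂ (λ c s → c ≤ s ∸ (n ∸ 2)) (coverCount-cong all-near) (count-cong all-near) (upto (N ∸ 1) N-1<N)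
        where
        N-1<N : N ∸ 1 < N
        N-1<N = ∸-monoʳ-< {N} {1} {0} z<s (≤-trans (s≤s z≤n) (≤-trans n≥2 (m≤m+n n k)))
        upto : ∀ R → R < N → coverCount (near R) ≤ count (near R) ∸ (n ∸ 2)
        upto zero    _     = subst (_≤ count (near 0) ∸ (n ∸ 2)) (sym nothing-covered) z≤n
        upto (suc R) 1+R<N = cover-step R 1+R<N (upto R (<⇒≤ 1+R<N))
        all-near : ∀ a → near (N ∸ 1) a ≡ Q a
        all-near a = trans (cong (Q a ∧_) (≤ᵇ-true (<⇒≤∸1 (dist<N y a)))) (∧-identityʳ (Q a))

    up : Ranking → Fin N → Fin N → Bool
    up r c x = r c ≤ᵇ r x

    height : Ranking → Fin N → ℕ
    height r c = count (up r c)

    below : Ranking → Fin N → Fin N → Bool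
    below r a = not ∘ up r a

    row : Ranking → Fin N → ℕ
    row r a = count (reversedSet r a)

    ContiguousUpTo : Ranking → ℕ → Set
    ContiguousUpTo r j = ∀ c → height r c ≤ j → Contiguous n k (λ a → r c ≤ r a)

    k<N : k < N
    k<N = +-monoˡ-≤ k (≤-trans (s≤s z≤n) n≥2)

    N>0 : 0 < N
    N>0 = ≤-trans (s≤s z≤n) (≤-trans n≥2 (m≤m+n n k))

    module Ranked (r : Ranking) (r-injective : Injective _≡_ _≡_ r) where

      up-self : ∀ c → up r c c ≡ true
      up-self c = ≤ᵇ-true (≤-refl {r c})

      height-strict : ∀ {c c'} → r c < r c' → height r c' < height r c
      height-strict {c} {c'} lt =
        count-strict c (λ a c'≤a → ≤ᵇ-true (≤-trans (<⇒≤ lt) (true-≤ᵇ {r c'} {r a} c'≤a))) (≤ᵇ-false lt) (up-self c)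

      height-antitone : ∀ {c c'} → r c ≤ r c' → height r c' ≤ height r c
      height-antitone {c} {c'} le = count-mono λ a c'≤a → ≤ᵇ-true (≤-trans le (true-≤ᵇ {r c'} {r a} c'≤a))

      height-≤⇒ : ∀ {c c'} → height r c' ≤ height r c → r c ≤ r c'
      height-≤⇒ {c} {c'} le with r c ≤? r c'
      ... | yes rc≤rc' = rc≤rc'
      ... | no  rc≰rc' = contradiction le (<⇒≱ (height-strict (≰⇒> rc≰rc')))

      height-injective : ∀ {c c'} → height r c ≡ height r c' → c ≡ c'
      height-injective {c} {c'} eq = r-injective (≤-antisym (height-≤⇒ (≤-reflexive (sym eq))) (height-≤⇒ (≤-reflexive eq)))

      height>0 : ∀ c → 0 < height r c
      height>0 c = ≤-<-trans z≤n (count-strict {Q = up r c} c (λ _ ()) refl (up-self c))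

      height≤N : ∀ c → height r c ≤ N
      height≤N c = count-≤ (up r c)

      private
        top-height : ∀ {c} → (∀ a → r a ≤ r c) → height r c ≡ 1
        top-height {c} c-top =
          trans (count-insert {P = λ _ → false} c refl (up-self c) outside) (cong suc (count-none {N} λ _ → refl))
          where
          outside : ∀ a → a ≢ c → false ≡ up r c a
          outside a a≢c = sym (≤ᵇ-false (≤∧≢⇒< (c-top a) (a≢c ∘ r-injective)))

        next-height : ∀ {c c'} → r c' < r c → (∀ a → r a < r c → r a ≤ r c') → height r c' ≡ suc (height r c)
        next-height {c} {c'} c'<c c'-top = count-insert c' (≤ᵇ-false c'<c) (up-self c') agree
          where
          agree : ∀ a → a ≢ c' → up r c a ≡ up r c' a
          agree a a≢c' with r c ≤? r a
          ... | yes c≤a = trans (≤ᵇ-true c≤a) (sym (≤ᵇ-true (≤-trans (<⇒≤ c'<c) c≤a)))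
          ... | no  c≰a = trans (≤ᵇ-false (≰⇒> c≰a))
                                (sym (≤ᵇ-false (≤∧≢⇒< (c'-top a (≰⇒> c≰a)) (a≢c' ∘ r-injective))))

      level-exists : ∀ t → t < N → ∃ λ c → height r c ≡ suc t
      level-exists zero t<N with argmax-exists {P = λ _ → ⊤} (λ _ → yes tt) r {fromℕ< t<N} tt
      ... | c , _ , c-top = c , top-height (λ a → c-top a tt)
      level-exists (suc t) 1+t<N with level-exists t (<⇒≤ 1+t<N)
      ... | c , hc≡1+t = c' , trans (next-height c'<c c'-top) (cong suc hc≡1+t)
        where
        c-not-bottom : ¬ (∀ a → r c ≤ r a)
        c-not-bottom c-bottom = <-irrefl (trans (sym hc≡1+t) (count-all (λ a → ≤ᵇ-true (c-bottom a)))) 1+t<N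
        below-c = ¬∀⟶∃¬ N (λ a → r c ≤ r a) (λ a → r c ≤? r a) c-not-bottom
        c'-spec = argmax-exists (λ a → r a <? r c) r {proj₁ below-c} (≰⇒> (proj₂ below-c))
        c' = proj₁ c'-spec
        c'<c = proj₁ (proj₂ c'-spec)
        c'-top = proj₂ (proj₂ c'-spec)

      private
        levelFor : ∀ {t} → Dec (t < N) → Fin N
        levelFor {t} (yes t<N) = proj₁ (level-exists t t<N)
        levelFor     (no  _)   = proj₁ (level-exists 0 N>0)

      -- level t has height t + 1; for t ≥ N the value is junk.
      level : ℕ → Fin N
      level t = levelFor (t <? N)

      level-height : ∀ {t} → t < N → height r (level t) ≡ suc t
      level-height {t} t<N = chosen (t <? N)
        where
        chosen : (d : Dec (t < N)) → height r (levelFor d) ≡ suc t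
        chosen (yes t<N′) = proj₂ (level-exists t t<N′)
        chosen (no  t≮N) = contradiction t<N t≮N

      height-1<N : ∀ a → height r a ∸ 1 < N
      height-1<N a = ≤-trans (≤-reflexive (m+[n∸m]≡n (height>0 a))) (height≤N a)

      level-height-1 : ∀ a → level (height r a ∸ 1) ≡ a
      level-height-1 a = height-injective (trans (level-height (height-1<N a)) (m+[n∸m]≡n (height>0 a)))

      levels : Permutation′ N
      levels = permutation (level ∘ toℕ) position level-position position-level
        where
        position : Fin N → Fin N
        position a = fromℕ< (height-1<N a)
        level-position : ∀ a → level (toℕ (position a)) ≡ a
        level-position a = trans (cong level (toℕ-fromℕ< (height-1<N a))) (level-height-1 a)
        position-level : ∀ i → position (level (toℕ i)) ≡ i
        position-level i = toℕ-injective (trans (toℕ-fromℕ< _) (cong (_∸ 1) (level-height (toℕ<n i))))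

      reversed⇒covers : ∀ {a b} → Reversed r a b → Covers (below r a) b
      reversed⇒covers {a} {b} rev x x∈↓b with r a ≤? r x
      ... | yes a≤x = contradiction (↓⇒Lt b x x∈↓b) (Inc⇒¬Lt x b (rev x a≤x))
      ... | no  a≰x = cong not (≤ᵇ-false (≰⇒> a≰x))

      covers⇒reversed : ∀ {a b} → Covers (below r a) b → Reversed r a b
      covers⇒reversed {a} {b} cov x a≤x with Inc⊎Lt x b
      ... | inj₁ inc = inc
      ... | inj₂ x<b = contradiction (trans (sym (cov x (Lt⇒↓ b x x<b))) (cong not (≤ᵇ-true a≤x))) λ ()

      row≡coverCount : ∀ a → row r a ≡ coverCount (below r a)
      row≡coverCount a = count-cong λ b → bool-ext (⇒covered ∘ reversed⇒covers ∘ ∈reversedSet⇒ {r} {a} {b})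
                                                   (⇒∈reversedSet ∘ covers⇒reversed ∘ covered⇒ {below r a} {b})

      count-below : ∀ a → count (below r a) ≡ N ∸ height r a
      count-below a = trans (sym (m+n∸n≡m _ (height r a))) (cong (_∸ height r a) (count-not (up r a)))

      row-bound : ∀ a → row r a ≤ (N ∸ height r a) ∸ (n ∸ 2)
      row-bound a = subst₂ (λ c s → c ≤ s ∸ (n ∸ 2)) (sym (row≡coverCount a)) (count-below a)
                           (coverCount-bound (below r a) a (cong not (up-self a)))

      row-pos : ∀ {a b} → Reversed r a b → 0 < row r a
      row-pos {a} {b} rev = ≤-<-trans z≤n (count-strict {P = λ _ → false} b (λ _ ()) refl (⇒∈reversedSet rev))

      up-successor : ∀ {x z} → height r z ≡ suc (height r x) → ∀ a → r z < r a ⇔ r x ≤ r a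
      up-successor {x} {z} hz≡1+hx a = mk⇔ to from
        where
        z<x : r z < r x
        z<x = ≰⇒> λ x≤z → <-irrefl refl (<-≤-trans (≤-reflexive (sym hz≡1+hx)) (height-antitone x≤z))
        to : r z < r a → r x ≤ r a
        to z<a with r x ≤? r a
        ... | yes x≤a = x≤a
        ... | no  x≰a = contradiction (≤-trans (height-strict z<a) (≤-reflexive hz≡1+hx))
                                      (<⇒≱ (s≤s (height-strict (≰⇒> x≰a))))
        from : r x ≤ r a → r z < r a
        from = <-≤-trans z<x

      up-block : ∀ {j} → ContiguousUpTo r j → 1 ≤ j → j < N → ∃ λ c → Block c j (λ a → r (level j) < r a)
      up-block {j} contiguous 1≤j j<N = c , λ a → mk⇔
        (Equivalence.to (proj₂ block-x a) ∘ ≤ᵇ-true ∘ Equivalence.to (up-successor z-after-x a))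
        (Equivalence.from (up-successor z-after-x a) ∘ true-≤ᵇ {r x} {r a} ∘ Equivalence.from (proj₂ block-x a))
        where
        x = level (j ∸ 1)
        hx : height r x ≡ j
        hx = trans (level-height (≤-<-trans (m∸n≤m j 1) j<N)) (m+[n∸m]≡n 1≤j)
        z-after-x : height r (level j) ≡ suc (height r x)
        z-after-x = trans (level-height j<N) (cong suc (sym hx))
        block-x = Contiguous⇒Block (Contiguous-resp (λ _ → ≤ᵇ-true) (λ a → true-≤ᵇ {r x} {r a}) (contiguous x (≤-reflexive hx)))
                                   hx 1≤j j<N
        c = proj₁ block-x

      card-reversedSet : card n k (reversedSet r) ≡ sumTo N (λ t → row r (level t))
      card-reversedSet = begin
        card n k (reversedSet r)         ≡⟨ card≡sum (reversedSet r) ⟩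
        sum (row r)                      ≡⟨ sum-permute (row r) levels ⟩
        sum (λ (i : Fin N) → row r (level (toℕ i))) ≡⟨ sum-toℕ N (λ t → row r (level t)) ⟩
        sumTo N (λ t → row r (level t))  ∎
        where open ≡-Reasoning

      row-level : ∀ {t} → t < N → row r (level t) ≤ suc k ∸ t
      row-level {t} t<N = subst (row r (level t) ≤_)
        (trans (cong (λ h → (N ∸ h) ∸ (n ∸ 2)) (level-height t<N)) (∸-suc-∸ n k t n≥2)) (row-bound (level t))

      private
        ∈-levels⇔ : ∀ {d a} → d < N →
                    (a ∈ applyUpTo level (suc d) → r (level d) ≤ r a) × (r (level d) ≤ r a → a ∈ applyUpTo level (suc d))
        ∈-levels⇔ {d} {a} d<N = from , to
          where
          from : a ∈ applyUpTo level (suc d) → r (level d) ≤ r a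
          from a∈ with ∈-applyUpTo⁻ level a∈
          ... | t , s≤s t≤d , refl =
            height-≤⇒ (subst₂ _≤_ (sym (level-height (≤-<-trans t≤d d<N))) (sym (level-height d<N)) (s≤s t≤d))
          to : r (level d) ≤ r a → a ∈ applyUpTo level (suc d)
          to d≤a = subst (_∈ applyUpTo level (suc d)) (level-height-1 a)
                     (∈-applyUpTo⁺ level (s≤s (∸-monoˡ-≤ 1 (≤-trans (height-antitone d≤a) (≤-reflexive (level-height d<N))))))

      levels-contiguous : ContiguousUpTo r (suc k) → ∀ d → d ≤ suc k → Contiguous n k (λ a → a ∈ applyUpTo level d)
      levels-contiguous contiguous zero    _        = inj₁ λ a ()
      levels-contiguous contiguous (suc d) 1+d≤1+k =
        Contiguous-resp (λ a → proj₂ (∈-levels⇔ d<N)) (λ a → proj₁ (∈-levels⇔ d<N))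
                        (contiguous (level d) (≤-trans (≤-reflexive (level-height d<N)) 1+d≤1+k))
        where
        d<N : d < N
        d<N = ≤-trans 1+d≤1+k k<N

      reversed⇒low : ∀ {a b} → Reversed r a b → height r a ∸ 1 < suc k
      reversed⇒low {a} rev = ≰⇒> λ 1+k≤t → <⇒≱ (row-pos rev) (begin
        row r a                        ≡⟨ cong (row r) (level-height-1 a) ⟨
        row r (level (height r a ∸ 1)) ≤⟨ row-level (height-1<N a) ⟩
        suc k ∸ (height r a ∸ 1)       ≡⟨ m≤n⇒m∸n≡0 1+k≤t ⟩
        0                              ∎)
        where open ≤-Reasoning

      representation⇒canonical : ∀ {S} → (∀ a b → S a b ≡ true → Reversed r a b) →
                                 (∀ a b → Reversed r a b → S a b ≡ true) →
                                 ContiguousUpTo r (suc k) → Canonical n k S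
      representation⇒canonical {S} sound complete contiguous =
        σ , (applyUpTo⁺₁ level (suc k) distinct , prefixes) , length-applyUpTo level (suc k) , λ a b → mk⇔ (to a b) (from a b)
        where
        σ = applyUpTo level (suc k)
        distinct : ∀ {i j} → i < j → j < suc k → level i ≢ level j
        distinct {i} {j} i<j j≤k eq = <⇒≢ i<j (suc-injective (trans (sym (level-height (<-trans i<j j<N)))
                                                               (trans (cong (height r) eq) (level-height j<N))))
          where
          j<N : j < N
          j<N = ≤-trans j≤k k<N
        prefixes : ∀ m → Contiguous n k (λ a → a ∈ take m σ)
        prefixes m = subst (λ l → Contiguous n k (λ a → a ∈ l)) (sym (take-applyUpTo level m (suc k)))
                           (levels-contiguous contiguous (m ⊓ suc k) (m⊓n≤n m (suc k)))
        to : ∀ a b → S a b ≡ true → InT n k σ a b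
        to a b ab∈S = InT-applyUpTo⁺ level (suc k) (height r a ∸ 1) (reversed⇒low rev) (sym (level-height-1 a)) incs
          where
          rev = sound a b ab∈S
          incs : ∀ u → u ≤ height r a ∸ 1 → Inc n k (level u) b
          incs u u≤t = rev (level u) (height-≤⇒ (≤-trans (≤-reflexive (level-height u<N))
                                                          (≤-trans (s≤s u≤t) (≤-reflexive (m+[n∸m]≡n (height>0 a))))))
            where
            u<N : u < N
            u<N = ≤-<-trans u≤t (height-1<N a)
        from : ∀ a b → InT n k σ a b → S a b ≡ true
        from a b a∈T with InT-applyUpTo⁻ level (suc k) a∈T
        ... | t , t≤k , refl , incs = complete (level t) b λ y t≤y →
          subst (λ z → Inc n k z b) (level-height-1 y)
                (incs (height r y ∸ 1)
                      (∸-monoˡ-≤ 1 (≤-trans (height-antitone t≤y) (≤-reflexive (level-height (≤-trans t≤k k<N))))))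


  -- Making the up-sets contiguous level by level

  module Construction (n≥3 : 3 ≤ n) {S : SubPairs n k} (maximal : MaximalReversible n k S) where

    n≥2 : 2 ≤ n
    n≥2 = ≤-trans (s≤s (s≤s z≤n)) n≥3

    open Windows n≥2

    record Stage (j : ℕ) : Set where
      field
        r           : Ranking
        r-injective : Injective _≡_ _≡_ r
        sound       : ∀ a b → S a b ≡ true → Reversed r a b
        complete    : ∀ a b → Reversed r a b → S a b ≡ true
        contiguous  : ContiguousUpTo r j

    stage₁ : Stage 1
    stage₁ = record
      { r = r ; r-injective = r-injective ; sound = sound ; complete = complete ; contiguous = singleton }
      where
      open Representation (maximal⇒representation maximal)
      open Ranked r r-injective
      singleton : ContiguousUpTo r 1
      singleton c hc≤1 = Block⇒Contiguous z<s λ a → mk⇔ (to a) (from a)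
        where
        to : ∀ a → r c ≤ r a → dist c a < 1
        to a c≤a with a ≟ᶠ c
        ... | yes refl = s≤s (≤-reflexive (dist-self a))
        ... | no  a≢c  = contradiction (≤-trans (s≤s (height>0 a)) (≤-trans (height-strict (≤∧≢⇒< c≤a (a≢c ∘ sym ∘ r-injective))) hc≤1))
                                       (<-irrefl refl)
        from : ∀ a → dist c a < 1 → r c ≤ r a
        from a ca<1 = ≤-reflexive (cong r (dist≡0⇒≡ (n<1⇒n≡0 ca<1)))

    module _ (r : Ranking) {y z : Fin N} (y<z : r y < r z) where

      private
        r′ = raise r y z

        double-≤ : ∀ {u v} → u ≤ v → 2 * u ≤ 2 * v
        double-≤ = *-monoʳ-≤ 2

        below-raised : ∀ {u} → u ≤ r z → 2 * u ≤ suc (2 * r z)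
        below-raised u≤z = m≤n⇒m≤1+n (double-≤ u≤z)

      raise-up-raised : ∀ a → r′ y ≤ r′ a ⇔ (r z < r a ⊎ a ≡ y)
      raise-up-raised a = mk⇔ (to (a ≟ᶠ y)) (from (a ≟ᶠ y))
        where
        to : Dec (a ≡ y) → r′ y ≤ r′ a → r z < r a ⊎ a ≡ y
        to (yes a≡y) _  = inj₂ a≡y
        to (no  a≢y) le = inj₁ (raise-self-≤ r y z a≢y le)
        from : Dec (a ≡ y) → r z < r a ⊎ a ≡ y → r′ y ≤ r′ a
        from (yes refl) _           = ≤-refl
        from (no  a≢y)  (inj₂ a≡y)  = contradiction a≡y a≢y
        from (no  a≢y)  (inj₁ z<a)  = subst₂ _≤_ (sym (raise-self r y z)) (sym (raise-other r y z a≢y))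
                                        (≤-trans (n≤1+n _) (≤-trans (≤-reflexive (sym (*-suc 2 (r z)))) (double-≤ z<a)))

      raise-up-above : ∀ {c} → c ≢ y → r z < r c → ∀ a → r′ c ≤ r′ a ⇔ r c ≤ r a
      raise-up-above {c} c≢y z<c a = mk⇔ (to (a ≟ᶠ y)) (from (a ≟ᶠ y))
        where
        to : Dec (a ≡ y) → r′ c ≤ r′ a → r c ≤ r a
        to (yes refl) le = contradiction (raise-≤-self r a z c≢y le) (<⇒≱ z<c)
        to (no  a≢y)  le = raise-≤-other r y z c≢y a≢y le
        from : Dec (a ≡ y) → r c ≤ r a → r′ c ≤ r′ a
        from (yes refl) c≤y = contradiction (<-trans (≤-<-trans c≤y y<z) z<c) (<-irrefl refl)
        from (no  a≢y)  c≤a = subst₂ _≤_ (sym (raise-other r y z c≢y)) (sym (raise-other r y z a≢y)) (double-≤ c≤a)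

      raise-height-below : ∀ {c} → c ≢ y → r c ≤ r z → height r z < height r′ c
      raise-height-below {c} c≢y c≤z = count-strict y up-z⊆ (≤ᵇ-false y<z)
        (≤ᵇ-true (subst₂ _≤_ (sym (raise-other r y z c≢y)) (sym (raise-self r y z)) (below-raised c≤z)))
        where
        up-z⊆ : up r z ⊆ᵇ up r′ c
        up-z⊆ a z≤a = ≤ᵇ-true (cases (a ≟ᶠ y))
          where
          cases : Dec (a ≡ y) → r′ c ≤ r′ a
          cases (yes refl) = contradiction (true-≤ᵇ {r z} {r a} z≤a) (<⇒≱ y<z)
          cases (no  a≢y)  = subst₂ _≤_ (sym (raise-other r y z c≢y)) (sym (raise-other r y z a≢y))
                               (double-≤ (≤-trans c≤z (true-≤ᵇ {r z} {r a} z≤a)))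

    exchange : ∀ {j} (st : Stage j) → let open Stage st in
               ∀ {y z} → height r z ≡ suc j → r y < r z → Contiguous n k (λ a → r z < r a ⊎ a ≡ y) →
               (∀ b → Reversed r z b → Inc n k y b) → Stage (suc j)
    exchange {j} st {y} {z} hz≡1+j y<z contiguous-y z⇒y = record
      { r           = r′
      ; r-injective = raise-injective r y z r-injective
      ; sound       = λ a b → grows a b ∘ sound a b
      ; complete    = maximal-absorbs maximal representation r′ (raise-injective r y z r-injective) grows
      ; contiguous  = contiguous′
      }
      where
      open Stage st
      open Ranked r r-injective
      r′ = raise r y z
      representation : Representation S
      representation = record { r = r ; r-injective = r-injective ; sound = sound ; complete = complete }
      grows : ∀ a b → Reversed r a b → Reversed r′ a b
      grows = raise-reversed r y z y<z z⇒y
      contiguous′ : ContiguousUpTo r′ (suc j)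
      contiguous′ c h′c≤1+j = cases (c ≟ᶠ y) (r z <? r c)
        where
        cases : Dec (c ≡ y) → Dec (r z < r c) → Contiguous n k (λ a → r′ c ≤ r′ a)
        cases (yes refl) _         = Contiguous-resp (λ a → Equivalence.from (raise-up-raised r y<z a))
                                                     (λ a → Equivalence.to (raise-up-raised r y<z a)) contiguous-y
        cases (no c≢y)   (yes z<c) = Contiguous-resp (λ a → Equivalence.from (raise-up-above r y<z c≢y z<c a))
                                                     (λ a → Equivalence.to (raise-up-above r y<z c≢y z<c a))
                                                     (contiguous c (≤-pred (subst (height r c <_) hz≡1+j (height-strict z<c))))
        cases (no c≢y)   (no  z≮c) = contradiction
          (≤-trans (subst (_< height r′ c) hz≡1+j (raise-height-below r y<z c≢y (≮⇒≥ z≮c))) h′c≤1+j)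
                                                   (<-irrefl refl)

    extend : ∀ {j} (st : Stage j) → let open Stage st in
             ∀ {z} → height r z ≡ suc j → Contiguous n k (λ a → r z < r a ⊎ a ≡ z) → Stage (suc j)
    extend {j} st {z} hz≡1+j contiguous-z = record
      { r = r ; r-injective = r-injective ; sound = sound ; complete = complete ; contiguous = contiguous′ }
      where
      open Stage st
      open Ranked r r-injective
      up-z : ∀ a → r z ≤ r a ⇔ (r z < r a ⊎ a ≡ z)
      up-z a = mk⇔ to from
        where
        to : r z ≤ r a → r z < r a ⊎ a ≡ z
        to z≤a with a ≟ᶠ z
        ... | yes a≡z = inj₂ a≡z
        ... | no  a≢z = inj₁ (≤∧≢⇒< z≤a (a≢z ∘ sym ∘ r-injective))
        from : r z < r a ⊎ a ≡ z → r z ≤ r a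
        from (inj₁ z<a)  = <⇒≤ z<a
        from (inj₂ refl) = ≤-refl
      contiguous′ : ContiguousUpTo r (suc j)
      contiguous′ c hc≤1+j with height r c ≤? j
      ... | yes hc≤j = contiguous c hc≤j
      ... | no  hc≰j = subst (λ c → Contiguous n k (λ a → r c ≤ r a))
                             (height-injective (trans hz≡1+j (≤-antisym (≰⇒> hc≰j) hc≤1+j)))
                         (Contiguous-resp (λ a → Equivalence.from (up-z a)) (λ a → Equivalence.to (up-z a)) contiguous-z)

    -- The up-set above z = level j is the block [c, c + j), z is not adjacent to it, and both
    -- neighbours yʳ = c + j and yˡ = c − 1 of the block are obstructed.
    record Exceptional (r : Ranking) (j : ℕ) : Set where
      field
        1≤j      : 1 ≤ j
        j≤k      : j ≤ k
        c z      : Fin N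
        height-z : height r z ≡ suc j
        block    : Block c j (λ a → r z < r a)
        j<cz     : j < dist c z
        cz<N-1   : suc (dist c z) < N
        yʳ yˡ    : Fin N
        c→yʳ     : dist c yʳ ≡ j
        c→yˡ     : dist c yˡ ≡ N ∸ 1
        b₁ b₂    : Fin N
        z-b₁     : Reversed r z b₁
        yʳ<b₁    : Lt n k yʳ b₁
        z-b₂     : Reversed r z b₂
        yˡ<b₂    : Lt n k yˡ b₂

    advance : ∀ {j} → 1 ≤ j → j ≤ k → (st : Stage j) → Stage (suc j) ⊎ Exceptional (Stage.r st) j
    advance {j} 1≤j j≤k st =
      decide (dist c z ≟ j) (dist c z ≟ N ∸ 1) (obstructs? r z yʳ) (obstructs? r z yˡ)
      where
      open Stage st
      open Ranked r r-injective
      j<N : j < N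
      j<N = ≤-<-trans j≤k k<N
      N-1<N : N ∸ 1 < N
      N-1<N = ∸-monoʳ-< {N} {1} {0} z<s (≤-trans 1≤j (<⇒≤ j<N))
      z = level j
      hz : height r z ≡ suc j
      hz = level-height j<N
      c = proj₁ (up-block contiguous 1≤j j<N)
      block = proj₂ (up-block contiguous 1≤j j<N)
      yʳ = proj₁ (dist-surjectiveʳ c j<N)
      yˡ = proj₁ (dist-surjectiveʳ c N-1<N)
      c→yʳ = proj₂ (dist-surjectiveʳ c j<N)
      c→yˡ = proj₂ (dist-surjectiveʳ c N-1<N)
      j≤cz : j ≤ dist c z
      j≤cz = ≮⇒≥ λ cz<j → <-irrefl refl (Equivalence.from (block z) cz<j)
      below-z : ∀ {y} → j ≤ dist c y → dist c y ≢ dist c z → r y < r z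
      below-z {y} j≤cy cy≢cz =
        ≤∧≢⇒< (≮⇒≥ λ z<y → <⇒≱ (Equivalence.to (block y) z<y) j≤cy) (cy≢cz ∘ cong (dist c) ∘ r-injective)
      decide : Dec (dist c z ≡ j) → Dec (dist c z ≡ N ∸ 1) → Dec (Obstructs r z yʳ) → Dec (Obstructs r z yˡ) →
               Stage (suc j) ⊎ Exceptional r j
      decide (yes cz≡j) _ _ _ = inj₁ (extend st hz (Block⇒Contiguous z<s (block-extendʳ block cz≡j)))
      decide (no _) (yes cz≡N-1) _ _ = inj₁ (extend st hz (Block⇒Contiguous z<s (block-extendˡ block j<N cz≡N-1)))
      decide (no cz≢j) (no _) (no free) _ =
        inj₁ (exchange st hz (below-z (≤-reflexive (sym c→yʳ)) (λ eq → cz≢j (trans (sym eq) c→yʳ)))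
                       (Block⇒Contiguous z<s (block-extendʳ block c→yʳ)) (¬obstructs⇒Inc {r} {z} {yʳ} free))
      decide (no _) (no cz≢N-1) (yes _) (no free) =
        inj₁ (exchange st hz (below-z (≤-trans (<⇒≤∸1 j<N) (≤-reflexive (sym c→yˡ)))
                                      (λ eq → cz≢N-1 (trans (sym eq) c→yˡ)))
                       (Block⇒Contiguous z<s (block-extendˡ block j<N c→yˡ)) (¬obstructs⇒Inc {r} {z} {yˡ} free))
      decide (no cz≢j) (no cz≢N-1) (yes (b₁ , z-b₁ , yʳ<b₁)) (yes (b₂ , z-b₂ , yˡ<b₂)) = inj₂ (record
        { 1≤j = 1≤j ; j≤k = j≤k ; c = c ; z = z ; height-z = hz ; block = block
        ; j<cz = ≤∧≢⇒< j≤cz (cz≢j ∘ sym)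
        ; cz<N-1 = ≤-trans (s≤s (≤∧≢⇒< (<⇒≤∸1 (dist<N c z)) cz≢N-1))
                           (≤-reflexive (m+[n∸m]≡n (≤-trans 1≤j (<⇒≤ j<N))))
        ; yʳ = yʳ ; yˡ = yˡ ; c→yʳ = c→yʳ ; c→yˡ = c→yˡ
        ; b₁ = b₁ ; b₂ = b₂ ; z-b₁ = z-b₁ ; yʳ<b₁ = yʳ<b₁ ; z-b₂ = z-b₂ ; yˡ<b₂ = yˡ<b₂ })

    Stuck : Set
    Stuck = ∃ λ j → Σ (Stage j) λ st → Exceptional (Stage.r st) j

    private
      iterate : ∀ d {j} → j + d ≡ suc k → 1 ≤ j → Stage j → Stage (suc k) ⊎ Stuck
      iterate zero    {j} j+0≡1+k _ st = inj₁ (subst Stage (trans (sym (+-identityʳ j)) j+0≡1+k) st)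
      iterate (suc d) {j} j+1+d≡1+k 1≤j st with advance 1≤j j≤k st
        where
        j≤k : j ≤ k
        j≤k = ≤-pred (≤-trans (s≤s (m≤m+n j d)) (≤-reflexive (trans (sym (+-suc j d)) j+1+d≡1+k)))
      ... | inj₁ st′  = iterate d (trans (sym (+-suc j d)) j+1+d≡1+k) (s≤s z≤n) st′
      ... | inj₂ exc  = inj₂ (j , st , exc)

    canonical-or-stuck : Canonical n k S ⊎ Stuck
    canonical-or-stuck with iterate k refl (s≤s z≤n) stage₁
    ... | inj₁ st    = inj₁ (Ranked.representation⇒canonical (Stage.r st) (Stage.r-injective st)
                               (Stage.sound st) (Stage.complete st) (Stage.contiguous st))
    ... | inj₂ stuck = inj₂ stuck

    -- The exceptional configuration

    module _ {j} (st : Stage j) (exc : Exceptional (Stage.r st) j) where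

      open Stage st
      open Exceptional exc
      open Ranked r r-injective

      private
        w = dist c z

        -- Off the block and z, the cycle splits into the gap between the block and z and the rest.
        inner outer : Fin N → Bool
        inner a = (j ≤ᵇ dist c a) ∧ (suc (dist c a) ≤ᵇ w)
        outer a = suc w ≤ᵇ dist c a

        inner⇒ : ∀ {a} → inner a ≡ true → j ≤ dist c a × dist c a < w
        inner⇒ {a} eq = true-≤ᵇ {j} (∧-conicalˡ _ _ eq) , true-≤ᵇ {suc (dist c a)} (∧-conicalʳ _ _ eq)

        ⇒inner : ∀ {a} → j ≤ dist c a → dist c a < w → inner a ≡ true
        ⇒inner j≤ca ca<w = cong₂ _∧_ (≤ᵇ-true j≤ca) (≤ᵇ-true ca<w)

        outer⇒ : ∀ {a} → outer a ≡ true → w < dist c a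
        outer⇒ {a} = true-≤ᵇ {suc w}

        ⇒outer : ∀ {a} → w < dist c a → outer a ≡ true
        ⇒outer = ≤ᵇ-true

        inner∩outer≡∅ : ∀ a → inner a ≡ true → outer a ≡ false
        inner∩outer≡∅ a in-a = ≤ᵇ-false (≤-trans (proj₂ (inner⇒ in-a)) (n≤1+n w))

        gap : (Fin N → Bool) → ℕ → ℕ
        gap G t = count (λ a → below r (level t) a ∧ G a)

        c∈block : r z < r c
        c∈block = Equivalence.from (block c) (subst (_< j) (sym (dist-self c)) 1≤j)

        module AtLevel {t} (j≤t : j ≤ t) (t<N : t < N) where

          Q : Fin N → Bool
          Q = below r (level t)

          level≤z : r (level t) ≤ r z
          level≤z = height-≤⇒ (subst₂ _≤_ (sym height-z) (sym (level-height t<N)) (s≤s j≤t))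

          z∉Q : Q z ≡ false
          z∉Q = cong not (≤ᵇ-true level≤z)

          c∉Q : Q c ≡ false
          c∉Q = cong not (≤ᵇ-true (≤-trans level≤z (<⇒≤ c∈block)))

          Q⊆inner∪outer : ∀ a → Q a ≡ true → inner a ≡ true ⊎ outer a ≡ true
          Q⊆inner∪outer a a∈Q = classify (<-cmp (dist c a) w)
            where
            a<z : r a < r z
            a<z = <-≤-trans (false-≤ᵇ {r (level t)} (not-injective a∈Q)) level≤z
            j≤ca : j ≤ dist c a
            j≤ca = ≮⇒≥ λ ca<j → <-asym a<z (Equivalence.from (block a) ca<j)
            classify : Tri (dist c a < w) (dist c a ≡ w) (w < dist c a) → inner a ≡ true ⊎ outer a ≡ true
            classify (tri< ca<w _ _) = inj₁ (⇒inner j≤ca ca<w)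
            classify (tri≈ _ ca≡w _) = contradiction (cong r (dist-injectiveʳ c ca≡w)) (<⇒≢ a<z)
            classify (tri> _ _ w<ca) = inj₂ (⇒outer w<ca)

          private
            restrict : ∀ {b} (G H : Fin N → Bool) → (∀ a → Q a ≡ true → G a ≡ true ⊎ H a ≡ true) →
                       ¬ (∃ λ a → ↓ b a ≡ true × G a ≡ true) → Covers Q b → Covers (λ a → Q a ∧ H a) b
            restrict G H Q⊆G∪H no-G cov a a∈↓b with Q⊆G∪H a (cov a a∈↓b)
            ... | inj₁ Ga = contradiction (a , a∈↓b , Ga) no-G
            ... | inj₂ Ha = cong₂ _∧_ (cov a a∈↓b) Ha

          covered-split : ∀ b → Covers Q b → Covers (λ a → Q a ∧ inner a) b ⊎ Covers (λ a → Q a ∧ outer a) b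
          covered-split b cov with any? (λ a → (↓ b a ≟ᵇ true) ×-dec (inner a ≟ᵇ true))
          ... | no no-inner = inj₂ (restrict inner outer Q⊆inner∪outer no-inner cov)
          ... | yes (a₁ , a₁∈↓b , in-a₁) with any? (λ a → (↓ b a ≟ᵇ true) ×-dec (outer a ≟ᵇ true))
          ...   | no no-outer = inj₁ (restrict outer inner (λ a → [ inj₂ , inj₁ ]′ ∘ Q⊆inner∪outer a) no-outer cov)
          ...   | yes (a₂ , a₂∈↓b , out-a₂)
                  with window-between (↓⇒Lt b a₁ a₁∈↓b) (↓⇒Lt b a₂ a₂∈↓b) (proj₂ (inner⇒ in-a₁)) (outer⇒ out-a₂)
          ...     | inj₁ z<b = contradiction (trans (sym (cov z (Lt⇒↓ b z z<b))) z∉Q) λ ()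
          ...     | inj₂ c<b = contradiction (trans (sym (cov c (Lt⇒↓ b c c<b))) c∉Q) λ ()

          Qⁱ Qᵒ : Fin N → Bool
          Qⁱ a = Q a ∧ inner a
          Qᵒ a = Q a ∧ outer a

          p q : ℕ
          p = gap inner t
          q = gap outer t

          p+q : p + q ≡ N ∸ suc t
          p+q = begin
            p + q                 ≡⟨ count-partition Q⊆inner∪outer inner∩outer≡∅ ⟨
            count Q               ≡⟨ count-below (level t) ⟩
            N ∸ height r (level t) ≡⟨ cong (N ∸_) (level-height t<N) ⟩
            N ∸ suc t             ∎
            where open ≡-Reasoning

          row-split : row r (level t) ≤ (p ∸ (n ∸ 2)) + (q ∸ (n ∸ 2))
          row-split = begin
            row r (level t)                ≡⟨ row≡coverCount (level t) ⟩
            coverCount Q                   ≤⟨ count-∪ (λ b → Sum.map ⇒covered ⇒covered ∘ covered-split b ∘ covered⇒) ⟩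
            coverCount Qⁱ + coverCount Qᵒ  ≤⟨ +-mono-≤ (coverCount-bound Qⁱ z (cong (_∧ _) z∉Q))
                                                       (coverCount-bound Qᵒ z (cong (_∧ _) z∉Q)) ⟩
            (p ∸ (n ∸ 2)) + (q ∸ (n ∸ 2))  ∎
            where open ≤-Reasoning

          level-bound : t ≤ k → row r (level t) + (p ⊓ q ⊓ (suc k ∸ t)) ⊓ (n ∸ 2) ≤ suc k ∸ t
          level-bound t≤k = level-budget row-split (trans p+q (∸-suc-split n k t n≥2 t≤k))

        gap-step : ∀ G {t} → suc t < N → gap G t ≤ suc (gap G (suc t))
        gap-step G {t} 1+t<N = count-⊆-insert (level (suc t)) λ a a≢next a∈ →
          cong₂ _∧_ (cong not (≤ᵇ-false (below-next a a≢next (not-injective (∧-conicalˡ _ _ a∈))))) (∧-conicalʳ _ _ a∈)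
          where
          next-after : height r (level (suc t)) ≡ suc (height r (level t))
          next-after = trans (level-height 1+t<N) (cong suc (sym (level-height (<-trans (n<1+n t) 1+t<N))))
          below-next : ∀ a → a ≢ level (suc t) → up r (level t) a ≡ false → r a < r (level (suc t))
          below-next a a≢next t≰a = ≰⇒> λ next≤a → contradiction (trans (sym t≰a)
            (≤ᵇ-true (Equivalence.to (up-successor next-after a) (≤∧≢⇒< next≤a (a≢next ∘ sym ∘ r-injective))))) λ ()

        φ : ℕ → ℕ
        φ t = gap inner t ⊓ gap outer t ⊓ (suc k ∸ t)

        φ-step : ∀ {t} → t < k → φ t ≤ suc (φ (suc t))
        φ-step {t} t<k = subst (λ T → gap inner t ⊓ gap outer t ⊓ T ≤ suc (φ (suc t))) (sym (+-∸-assoc 1 (<⇒≤ t<k)))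
          (⊓-monoˡ-≤ (suc (k ∸ t)) (⊓-mono-≤ (gap-step inner 1+t<N) (gap-step outer 1+t<N)))
          where
          1+t<N : suc t < N
          1+t<N = ≤-<-trans t<k k<N

        φ-last : φ k ≤ 1
        φ-last = ≤-trans (m⊓n≤n _ (suc k ∸ k)) (≤-reflexive (m+n∸n≡m 1 k))

        z≡level : level j ≡ z
        z≡level = height-injective (trans (level-height (≤-<-trans j≤k k<N)) (sym height-z))

        j<N : j < N
        j<N = ≤-<-trans j≤k k<N

        module First = AtLevel ≤-refl j<N

        z-covers : ∀ {b} → Reversed r z b → Covers First.Q b
        z-covers {b} z-b = subst (λ x → Covers (below r x) b) (sym z≡level) (reversed⇒covers z-b)

        inner-wide : n ∸ 1 ≤ gap inner j
        inner-wide with First.covered-split b₁ (z-covers z-b₁)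
        ... | inj₁ cov = covers⇒count cov
        ... | inj₂ cov = ⊥-elim (<-asym (outer⇒ {yʳ} (∧-conicalʳ _ _ (cov yʳ (Lt⇒↓ b₁ yʳ yʳ<b₁))))
                                        (subst (_< w) (sym c→yʳ) j<cz))

        outer-wide : n ∸ 1 ≤ gap outer j
        outer-wide with First.covered-split b₂ (z-covers z-b₂)
        ... | inj₂ cov = covers⇒count cov
        ... | inj₁ cov = ⊥-elim (<-asym (proj₂ (inner⇒ {yˡ} (∧-conicalʳ (First.Q yˡ) (inner yˡ) (cov yˡ (Lt⇒↓ b₂ yˡ yˡ<b₂)))))
                                        (subst (w <_) (sym c→yˡ) (<⇒≤∸1 cz<N-1)))

        room : n ≤ suc k ∸ j
        room = +-cancelʳ-≤ (n ∸ 2) _ _ (begin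
          n + (n ∸ 2)                 ≡⟨ +∸2≡∸1+∸1 n n≥2 ⟩
          (n ∸ 1) + (n ∸ 1)           ≤⟨ +-mono-≤ inner-wide outer-wide ⟩
          gap inner j + gap outer j   ≡⟨ First.p+q ⟩
          N ∸ suc j                   ≡⟨ ∸-suc-split n k j n≥2 j≤k ⟩
          (suc k ∸ j) + (n ∸ 2)       ∎)
          where open ≤-Reasoning

        n≤k : n ≤ k
        n≤k = ≤-trans room (∸-monoʳ-≤ (suc k) 1≤j)

        φ-first : n ∸ 1 ≤ φ j
        φ-first = ⊓-glb (⊓-glb inner-wide outer-wide) (≤-trans (m∸n≤m n 1) room)

        slack : ℕ → ℕ
        slack t with j ≤? t | t ≤? k
        ... | yes _ | yes _ = φ t ⊓ (n ∸ 2)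
        ... | _     | _     = 0

        row+slack : ∀ {t} → t < N → row r (level t) + slack t ≤ suc k ∸ t
        row+slack {t} t<N with j ≤? t | t ≤? k
        ... | yes j≤t | yes t≤k = AtLevel.level-bound j≤t t<N t≤k
        ... | yes _   | no  _   = subst (_≤ suc k ∸ t) (sym (+-identityʳ _)) (row-level t<N)
        ... | no  _   | _       = subst (_≤ suc k ∸ t) (sym (+-identityʳ _)) (row-level t<N)

        slack-inside : ∀ {t} → j ≤ t → t ≤ k → slack t ≡ φ t ⊓ (n ∸ 2)
        slack-inside {t} j≤t t≤k with j ≤? t | t ≤? k
        ... | yes _   | yes _   = refl
        ... | no  j≰t | _       = contradiction j≤t j≰t
        ... | yes _   | no  t≰k = contradiction t≤k t≰k

        slack-sum : staircase (n ∸ 2) (n ∸ 1) ≤ sumTo N slack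
        slack-sum = begin
          staircase m (n ∸ 1)                                    ≤⟨ slow-descent D (λ s → φ (j + s)) m last step first ⟩
          sumTo (suc D) (λ s → φ (j + s) ⊓ m)                    ≡⟨ sumTo-cong (suc D) inside ⟨
          sumTo (suc D) (λ s → slack (j + s))                    ≤⟨ sumTo-prefix (λ s → slack (j + s)) 1+D≤N-j ⟩
          sumTo (N ∸ j) (λ s → slack (j + s))                    ≤⟨ m≤n+m _ (sumTo j slack) ⟩
          sumTo j slack + sumTo (N ∸ j) (λ s → slack (j + s))    ≡⟨ sumTo-split j (N ∸ j) slack ⟨
          sumTo (j + (N ∸ j)) slack                              ≡⟨ cong (λ v → sumTo v slack) (m+[n∸m]≡n (<⇒≤ j<N)) ⟩
          sumTo N slack                                          ∎
          where
          open ≤-Reasoning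
          m = n ∸ 2
          D = k ∸ j
          j+D≡k : j + D ≡ k
          j+D≡k = m+[n∸m]≡n j≤k
          last : φ (j + D) ≤ 1
          last = subst (λ v → φ v ≤ 1) (sym j+D≡k) φ-last
          step : ∀ s → s < D → φ (j + s) ≤ suc (φ (j + suc s))
          step s s<D = subst (λ v → φ (j + s) ≤ suc (φ v)) (sym (+-suc j s)) (φ-step (subst (j + s <_) j+D≡k (+-monoʳ-< j s<D)))
          first : n ∸ 1 ≤ φ (j + 0)
          first = subst (λ v → n ∸ 1 ≤ φ v) (sym (+-identityʳ j)) φ-first
          inside : ∀ s → s < suc D → slack (j + s) ≡ φ (j + s) ⊓ m
          inside s s≤D = slack-inside (m≤m+n j s) (subst (j + s ≤_) j+D≡k (+-monoʳ-≤ j (≤-pred s≤D)))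
          1+D≤N-j : suc D ≤ N ∸ j
          1+D≤N-j = +-cancelˡ-≤ j _ _
            (subst₂ _≤_ (sym (trans (+-suc j D) (cong suc j+D≡k))) (sym (m+[n∸m]≡n (<⇒≤ j<N))) k<N)

      exceptional-bound : n ≤ k × 2 * card n k S + n * (n ∸ 1) ≤ (k + 1) * (k + 2) + 2
      exceptional-bound = n≤k , (begin
        2 * card n k S + n * (n ∸ 1)          ≡⟨ cong₂ (λ x y → 2 * x + y) card-S (sym staircase≡) ⟩
        2 * R + (2 * G + 2)                   ≡⟨ factor-2 R G ⟩
        2 * (R + G) + 2                       ≤⟨ +-monoˡ-≤ 2 (*-monoʳ-≤ 2 (≤-trans (+-monoʳ-≤ R slack-sum) rows+slacks)) ⟩
        2 * T + 2                             ≡⟨ cong (_+ 2) (trans (sumTo-countdown (suc k) N k<N) (sym (shape k))) ⟩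
        (k + 1) * (k + 2) + 2                 ∎)
        where
        open ≤-Reasoning
        R = sumTo N (λ t → row r (level t))
        G = staircase (n ∸ 2) (n ∸ 1)
        T = sumTo N (λ t → suc k ∸ t)
        card-S : card n k S ≡ R
        card-S = trans (card-cong λ a b → bool-ext (⇒∈reversedSet ∘ sound a b) (complete a b ∘ ∈reversedSet⇒)) card-reversedSet
        staircase≡ : 2 * G + 2 ≡ n * (n ∸ 1)
        staircase≡ = staircase-top n n≥2
        factor-2 : ∀ x y → 2 * x + (2 * y + 2) ≡ 2 * (x + y) + 2
        factor-2 = solve-∀
        rows+slacks : R + sumTo N slack ≤ T
        rows+slacks = subst (_≤ T) (sumTo-distrib-+ N _ slack) (sumTo-mono-≤ N λ t → row+slack)
        shape : ∀ k → (k + 1) * (k + 2) ≡ suc k * suc (suc k)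
        shape = solve-∀

    stuck-bound : Stuck → n ≤ k × 2 * card n k S + n * (n ∸ 1) ≤ (k + 1) * (k + 2) + 2
    stuck-bound (_ , st , exc) = exceptional-bound st exc

theorem1p3 : (n k : ℕ) → 3 ≤ n →
    ((S : SubPairs n k) → MaximalReversible n k S → MaximalIndependent n k S)
    × ((S : SubPairs n k) → k < n → MaximalReversible n k S → Canonical n k S)
    × ((S : SubPairs n k) → MaximalReversible n k S → ¬ Canonical n k S →
        n ≤ k × 2 * card n k S + n * (n ∸ 1) ≤ (k + 1) * (k + 2) + 2)
theorem1p3 n k n≥3 = part₁ , part₂ , part₃
  where
  open Crown n k
  open Construction n≥3 using (canonical-or-stuck; stuck-bound)
  part₁ : ∀ S → MaximalReversible n k S → MaximalIndependent n k S
  part₁ S = maximalReversible⇒maximalIndependent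
  part₂ : ∀ S → k < n → MaximalReversible n k S → Canonical n k S
  part₂ S k<n maximal =
    [ id , (λ stuck → contradiction (proj₁ (stuck-bound maximal stuck)) (<⇒≱ k<n)) ]′ (canonical-or-stuck maximal)
  part₃ : ∀ S → MaximalReversible n k S → ¬ Canonical n k S →
          n ≤ k × 2 * card n k S + n * (n ∸ 1) ≤ (k + 1) * (k + 2) + 2
  part₃ S maximal ¬canonical =
    [ (λ canonical → contradiction canonical ¬canonical) , stuck-bound maximal ]′ (canonical-or-stuck maximal)
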